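{- Let $G$ be a graph in $\varepsilon_3$. If $G$ is graceful, then the number of blocks of $G$ is of the form $4(t+1)$ or $4t+1$ for some integer $t\geq 0$.
   Context: All graphs are finite, simple, undirected and connected. An Euler graph is a connected graph in which every vertex has even degree. $\varepsilon_3$ denotes the class of Euler graphs $G$ such that every cycle of $G$ has length $n\equiv 3 \pmod 4$. A block is a maximal connected subgraph without cut vertices. A graph with $q$ edges is graceful if there is an injective map $\varphi$ from its vertex set to $\{0,1,\dots,q\}$ such that the edge labels $|\varphi(u)-\varphi(v)|$, over all edges $uv$, are exactly $\{1,2,\dots,q\}$. -}

module Defs where

open import Data.Nat using (ℕ; zero; suc; _+_; _*_; _≤_; _<ᵇ_; ∣_-_∣; _%_)
open import Data.Nat.Divisibility using (_∣_)
open import Data.Fin using (Fin; zero; suc; toℕ; inject₁; fromℕ)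
open import Data.List using (List; map; length)
open import Data.Nat.ListAction using (sum)
open import Data.List.Base using (allFin)
open import Data.List.Membership.Propositional using (_∈_)
open import Data.Bool using (Bool; true; false; T; _∧_; if_then_else_; not)
open import Data.Product using (Σ; ∃; _×_; _,_)
open import Relation.Binary.PropositionalEquality using (_≡_; _≢_)
open import Relation.Nullary using (¬_)
open import Function.Definitions using (Injective)

record Graph : Set where
  field
    n      : ℕ
    adj    : Fin n → Fin n → Bool
    sym    : ∀ u v → adj u v ≡ adj v u
    irrefl : ∀ v → adj v v ≡ false
open Graph public

numEdges : Graph → ℕ
numEdges G = sum (map (λ u → sum (map (λ v →
  if adj G u v ∧ (toℕ u <ᵇ toℕ v) then 1 else 0) (allFin (n G)))) (allFin (n G)))

degree : (G : Graph) → Fin (n G) → ℕ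
degree G v = sum (map (λ u → if adj G v u then 1 else 0) (allFin (n G)))

record Subgraph (G : Graph) : Set where
  field
    V : Fin (n G) → Bool
    E : Fin (n G) → Fin (n G) → Bool
    E-sym  : ∀ u v → E u v ≡ E v u
    E-adj  : ∀ u v → T (E u v) → T (adj G u v)
    E-ends : ∀ u v → T (E u v) → T (V u) × T (V v)
open Subgraph public

data Reach {m : ℕ} (S : Fin m → Bool) (E : Fin m → Fin m → Bool)
           : Fin m → Fin m → Set where
  here : ∀ {u} → T (S u) → Reach S E u u
  step : ∀ {u x w} → Reach S E u x → T (E x w) → T (S w) → Reach S E u w

ConnectedOn : {m : ℕ} → (Fin m → Bool) → (Fin m → Fin m → Bool) → Set
ConnectedOn {m} S E =
  (∃ λ v → T (S v)) × (∀ u w → T (S u) → T (S w) → Reach S E u w)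

Connected : Graph → Set
Connected G = ConnectedOn (λ _ → true) (adj G)

Euler : Graph → Set
Euler G = Connected G × (∀ v → 2 ∣ degree G v)

record Cycle (G : Graph) (k : ℕ) : Set where
  field
    m      : ℕ
    len    : k ≡ 3 + m
    c      : Fin (3 + m) → Fin (n G)
    c-inj  : Injective _≡_ _≡_ c
    c-step : ∀ (i : Fin (2 + m)) → T (adj G (c (inject₁ i)) (c (suc i)))
    c-close : T (adj G (c (fromℕ (2 + m))) (c zero))

InEps3 : Graph → Set
InEps3 G = Euler G × (∀ k → Cycle G k → k % 4 ≡ 3)

Graceful : Graph → Set
Graceful G = Σ (Fin (n G) → ℕ) λ φ →
    Injective _≡_ _≡_ φ
  × (∀ v → φ v ≤ numEdges G)
  × (∀ u v → T (adj G u v) →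
       1 ≤ ∣ φ u - φ v ∣ × ∣ φ u - φ v ∣ ≤ numEdges G)
  × (∀ l → 1 ≤ l → l ≤ numEdges G →
       ∃ λ u → ∃ λ v → T (adj G u v) × ∣ φ u - φ v ∣ ≡ l)

module _ {G : Graph} where
  _⊑_ : Subgraph G → Subgraph G → Set
  H ⊑ H' = (∀ v → T (V H v) → T (V H' v))
         × (∀ u w → T (E H u w) → T (E H' u w))

  _≈_ : Subgraph G → Subgraph G → Set
  H ≈ H' = (H ⊑ H') × (H' ⊑ H)

  CutVertex : Subgraph G → Fin (n G) → Set
  CutVertex H v = T (V H v) × ∃ λ u → ∃ λ w →
      let S = λ x → V H x ∧ not (isv x) in
      T (S u) × T (S w) × ¬ Reach S (E H) u w
    where
    isv : Fin (n G) → Bool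
    isv x = toℕ x Data.Nat.≡ᵇ toℕ v

  NoCutVertex : Subgraph G → Set
  NoCutVertex H = ∀ v → ¬ CutVertex H v

  ConnectedSub : Subgraph G → Set
  ConnectedSub H = ConnectedOn (V H) (E H)

  IsBlock : Subgraph G → Set
  IsBlock H = ConnectedSub H × NoCutVertex H
    × (∀ H' → ConnectedSub H' → NoCutVertex H' → H ⊑ H' → H' ⊑ H)

  BlockList : List (Subgraph G) → Set
  BlockList bs = (∀ H → H ∈ bs → IsBlock H)
    × (∀ H → IsBlock H → ∃ λ H' → H' ∈ bs × H ≈ H')
    × Pairwise (λ H H' → ¬ (H ≈ H')) bs
    where open import Data.List.Relation.Unary.AllPairs using () renaming (AllPairs to Pairwise)

NumBlocks : Graph → ℕ → Set
NumBlocks G b = ∃ λ (bs : List (Subgraph G)) → BlockList bs × length bs ≡ b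

module Submission where

-- Every cycle of G has length 3 mod 4, so G has no theta subgraph: paths of lengths a+1, b+1, c+1
-- between two vertices would give cycles of lengths 2+a+b, 2+a+c, 2+b+c, whose sum is even, not 1 mod 4.
-- Hence each block is a cycle: in an Euler graph every edge lies on a cycle (the part of G - uv
-- reachable from v has odd degree sum otherwise), such a cycle is itself a block, and a block
-- sharing an edge with it is equal to it. So the q edges split into b cycles and q ≡ 3b (mod 4).
-- A graceful labelling of an Euler graph has label sum 1 + ⋯ + q ≡ Σ φ(u) deg u ≡ 0 (mod 2), which
-- forces q ≡ 0 or 3 (mod 4); together with b ≥ 1 this gives b ≡ 0 or 1 (mod 4) as claimed.

open import Defs renaming (sym to adj-sym′)
open import Data.Bool using (Bool; true; false; T; _∧_; _∨_; not; if_then_else_)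
open import Data.Bool.Properties using (T?; T-≡)
open import Function.Bundles using (Equivalence)
open import Data.Empty using (⊥; ⊥-elim)
open import Data.Fin using (Fin; zero; suc; toℕ; inject₁; fromℕ; _≟_)
open import Data.Fin.Properties using (toℕ-injective; ¬Fin0) renaming (suc-injective to fsuc-injective)
open import Data.List using (List; []; _∷_; _++_; map; length; lookup; allFin; tabulate; reverse)
open import Data.List.Properties using (map-tabulate; ++-assoc; length-++; ++-identityʳ; length-reverse; reverse-++; unfold-reverse)
open import Data.List.Relation.Unary.Any using (here; there; toSum)
open import Data.List.Relation.Unary.Any.Properties using (reverse⁻)
open import Data.List.Relation.Binary.Disjoint.Propositional using (Disjoint)
open import Data.List.Relation.Unary.All using ([]; _∷_) renaming (lookup to All-lookup)
open import Data.List.Relation.Unary.AllPairs using (AllPairs; []; _∷_)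
open import Data.List.Membership.Propositional using (_∈_; _∉_)
import Data.List.Membership.DecPropositional as DecMembership
open import Data.List.Membership.Propositional.Properties using (∈-++⁺ˡ; ∈-++⁺ʳ; ∈-++⁻; ∈-∃++; ∈-map⁺; ∈-map⁻; ∈-lookup)
open import Data.Nat as ℕ using (ℕ; zero; suc; _+_; _*_; _∸_; _≤_; _<_; z≤n; s≤s; _<ᵇ_; _≡ᵇ_; _%_; ∣_-_∣; _⊓_)
open import Data.Nat.ListAction using (sum)
open import Data.Nat.ListAction.Properties using (sum-++)
open import Data.Nat.Divisibility using (_∣_; divides; ∣m∣n⇒∣m+n; ∣m+n∣m⇒∣n; ∣n⇒∣m*n; ∣m⇒∣m*n; ∣-refl; ∣1⇒≡1; _∣0)
open import Data.Nat.DivMod using (m≡m%n+[m/n]*n; _/_; [m+kn]%n≡m%n; %-distribˡ-+)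
open import Data.Nat.Tactic.RingSolver using (solve-∀)
open import Data.Nat.Properties hiding (_≟_)
open import Algebra.Properties.Semiring.Sum +-*-semiring
  using (sum-cong-≗; ∑-distrib-+; ∑-comm; *-distribˡ-sum; sum-replicate-zero)
  renaming (sum to ∑)
open import Data.Product using (Σ; ∃; ∃₂; _×_; _,_; proj₁; proj₂)
open import Data.Product.Properties using (≡-dec)
open import Data.Sum using (_⊎_; inj₁; inj₂; [_,_]′)
open import Data.Unit using (⊤; tt)
open import Relation.Binary.PropositionalEquality
open import Relation.Nullary using (¬_; Dec; yes; no)
open import Relation.Binary.Definitions using (tri<; tri≈; tri>)
open import Relation.Nullary.Decidable using (⌊_⌋; fromWitness; toWitness)

𝟙 : Bool → ℕ
𝟙 true = 1
𝟙 false = 0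

𝟙≤1 : ∀ b → 𝟙 b ≤ 1
𝟙≤1 true = s≤s z≤n
𝟙≤1 false = z≤n

𝟙-mono : ∀ {a b} → (T a → T b) → 𝟙 a ≤ 𝟙 b
𝟙-mono {false} f = z≤n
𝟙-mono {true} {true} f = s≤s z≤n
𝟙-mono {true} {false} f = ⊥-elim (f tt)

𝟙-∧ : ∀ a b → 𝟙 (a ∧ b) ≡ 𝟙 a * 𝟙 b
𝟙-∧ true true = refl
𝟙-∧ true false = refl
𝟙-∧ false b = refl

𝟙-if : ∀ b → (if b then 1 else 0) ≡ 𝟙 b
𝟙-if true = refl
𝟙-if false = refl

𝟙-true : ∀ {b} → T b → 𝟙 b ≡ 1
𝟙-true {true} _ = refl

𝟙-false : ∀ {b} → ¬ T b → 𝟙 b ≡ 0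
𝟙-false {true} f = ⊥-elim (f tt)
𝟙-false {false} _ = refl

T-injective : ∀ {a b : Bool} → (T a → T b) → (T b → T a) → a ≡ b
T-injective {true} {true} f g = refl
T-injective {true} {false} f g = ⊥-elim (f tt)
T-injective {false} {true} f g = ⊥-elim (g tt)
T-injective {false} {false} f g = refl

T-∧-intro : ∀ {a b} → T a → T b → T (a ∧ b)
T-∧-intro {true} {true} _ _ = tt

T-∧₁ : ∀ {a b} → T (a ∧ b) → T a
T-∧₁ {true} _ = tt

T-∧₂ : ∀ {a b} → T (a ∧ b) → T b
T-∧₂ {true} p = p

T-∨₁ : ∀ {a b} → T a → T (a ∨ b)
T-∨₁ {true} _ = tt

T-∨₂ : ∀ {a b} → T b → T (a ∨ b)
T-∨₂ {true} _ = tt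
T-∨₂ {false} p = p

T-∨-elim : ∀ {a b} → T (a ∨ b) → T a ⊎ T b
T-∨-elim {true} _ = inj₁ tt
T-∨-elim {false} p = inj₂ p

T-not : ∀ {a} → ¬ T a → T (not a)
T-not {true} f = f tt
T-not {false} f = tt

T-not⁻ : ∀ {a} → T (not a) → ¬ T a
T-not⁻ {true} () _
T-not⁻ {false} _ ()

-- The Boolean equality on vertices used by CutVertex in Defs.
_==_ : ∀ {n} → Fin n → Fin n → Bool
x == y = toℕ x ≡ᵇ toℕ y

==⇒≡ : ∀ {n} {x y : Fin n} → T (x == y) → x ≡ y
==⇒≡ {x = x} {y} p = toℕ-injective (≡ᵇ⇒≡ (toℕ x) (toℕ y) p)

≡⇒== : ∀ {n} {x y : Fin n} → x ≡ y → T (x == y)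
≡⇒== {x = x} {y} p = ≡⇒≡ᵇ (toℕ x) (toℕ y) (cong toℕ p)

𝟙-==-refl : ∀ {n} (x : Fin n) → 𝟙 (x == x) ≡ 1
𝟙-==-refl x = 𝟙-true (≡⇒== {x = x} refl)

𝟙-==-≢ : ∀ {n} {x y : Fin n} → x ≢ y → 𝟙 (x == y) ≡ 0
𝟙-==-≢ ne = 𝟙-false (λ t → ne (==⇒≡ t))

anyᶠ : ∀ {n} → (Fin n → Bool) → Bool
anyᶠ {zero} f = false
anyᶠ {suc n} f = f zero ∨ anyᶠ (λ i → f (suc i))

anyᶠ-intro : ∀ {n} (f : Fin n → Bool) (k : Fin n) → T (f k) → T (anyᶠ f)
anyᶠ-intro f zero t = T-∨₁ t
anyᶠ-intro f (suc k) t = T-∨₂ {f zero} (anyᶠ-intro (λ i → f (suc i)) k t)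

anyᶠ-elim : ∀ {n} (f : Fin n → Bool) → T (anyᶠ f) → ∃ λ k → T (f k)
anyᶠ-elim {suc n} f t with T-∨-elim {f zero} t
... | inj₁ a = zero , a
... | inj₂ b with anyᶠ-elim (λ i → f (suc i)) b
...   | k , p = suc k , p

∃ᶠ-or-∀ᶠ : ∀ {n} (f : Fin n → Bool) → (∃ λ k → T (f k)) ⊎ (∀ k → ¬ T (f k))
∃ᶠ-or-∀ᶠ f with T? (anyᶠ f)
... | yes a = inj₁ (anyᶠ-elim f a)
... | no na = inj₂ (λ k t → na (anyᶠ-intro f k t))

∑-mono : ∀ {n} {f g : Fin n → ℕ} → (∀ i → f i ≤ g i) → ∑ f ≤ ∑ g
∑-mono {zero} h = z≤n
∑-mono {suc n} h = +-mono-≤ (h zero) (∑-mono (λ i → h (suc i)))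

∑-strict : ∀ {n} {f g : Fin n → ℕ} → (∀ i → f i ≤ g i) → (k : Fin n) → f k < g k → ∑ f < ∑ g
∑-strict {suc n} h zero lt = +-mono-<-≤ lt (∑-mono (λ i → h (suc i)))
∑-strict {suc n} h (suc k) lt = +-mono-≤-< (h zero) (∑-strict (λ i → h (suc i)) k lt)

∑-≤-size : ∀ {n} (f : Fin n → ℕ) → (∀ i → f i ≤ 1) → ∑ f ≤ n
∑-≤-size {zero} f h = z≤n
∑-≤-size {suc n} f h = +-mono-≤ (h zero) (∑-≤-size (λ i → f (suc i)) (λ i → h (suc i)))

∑-zero : ∀ {n} (f : Fin n → ℕ) → (∀ i → f i ≡ 0) → ∑ f ≡ 0
∑-zero {n} f h = trans (sum-cong-≗ h) (sum-replicate-zero n)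

∑-single : ∀ {n} (f : Fin n → ℕ) (k : Fin n) → (∀ i → i ≢ k → f i ≡ 0) → ∑ f ≡ f k
∑-single {suc n} f zero h = trans (cong (f zero +_) (∑-zero _ (λ i → h (suc i) (λ ())))) (+-identityʳ _)
∑-single {suc n} f (suc k) h =
  trans (cong (_+ ∑ (λ i → f (suc i))) (h zero (λ ())))
        (∑-single (λ i → f (suc i)) k (λ i ne → h (suc i) (λ e → ne (fsuc-injective e))))

∑-𝟙-== : ∀ {n} (f : Fin n → ℕ) (v : Fin n) → ∑ (λ a → f a * 𝟙 (a == v)) ≡ f v
∑-𝟙-== f v = trans (∑-single _ v (λ i ne → trans (cong (f i *_) (𝟙-==-≢ ne)) (*-zeroʳ (f i))))
                   (trans (cong (f v *_) (𝟙-==-refl v)) (*-identityʳ (f v)))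

∑-𝟙-==ˡ : ∀ {n} (v : Fin n) → ∑ (λ a → 𝟙 (a == v)) ≡ 1
∑-𝟙-==ˡ v = trans (∑-single _ v (λ i ne → 𝟙-==-≢ ne)) (𝟙-==-refl v)

∑-divisible : ∀ {n} d (f : Fin n → ℕ) → (∀ i → d ∣ f i) → d ∣ ∑ f
∑-divisible {zero} d f h = d ∣0
∑-divisible {suc n} d f h = ∣m∣n⇒∣m+n (h zero) (∑-divisible d (λ i → f (suc i)) (λ i → h (suc i)))

sum-allFin : ∀ {n} (f : Fin n → ℕ) → sum (map f (allFin n)) ≡ ∑ f
sum-allFin {n} f = trans (cong sum (map-tabulate (λ i → i) f)) (sum-tabulate f)
  where
  sum-tabulate : ∀ {n} (f : Fin n → ℕ) → sum (tabulate f) ≡ ∑ f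
  sum-tabulate {zero} f = refl
  sum-tabulate {suc n} f = cong (f zero +_) (sum-tabulate (λ i → f (suc i)))

∑² : ∀ {n} → (Fin n → Fin n → ℕ) → ℕ
∑² f = ∑ (λ a → ∑ (λ b → f a b))

𝟙< : ∀ {n} → Fin n → Fin n → ℕ
𝟙< a b = 𝟙 (toℕ a <ᵇ toℕ b)

∑²-symmetric : ∀ {n} (f : Fin n → Fin n → ℕ) → (∀ a b → f a b ≡ f b a) → (∀ a → f a a ≡ 0) →
  ∑² f ≡ 2 * ∑² (λ a b → 𝟙< a b * f a b)
∑²-symmetric {zero} f sy d = refl
∑²-symmetric {suc n} f sy d = begin
    (f zero zero + X) + ∑ (λ a → f (suc a) zero + ∑ (λ b → f (suc a) (suc b)))
  ≡⟨ cong₂ _+_ (cong (_+ X) (d zero)) (∑-distrib-+ (λ a → f (suc a) zero) (λ a → ∑ (λ b → f (suc a) (suc b)))) ⟩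
    X + (∑ (λ a → f (suc a) zero) + ∑² f′)
  ≡⟨ cong (λ t → X + (t + ∑² f′)) (sum-cong-≗ (λ a → sy (suc a) zero)) ⟩
    X + (X + ∑² f′)
  ≡⟨ cong (λ t → X + (X + t)) (∑²-symmetric f′ (λ a b → sy (suc a) (suc b)) (λ a → d (suc a))) ⟩
    X + (X + 2 * R)
  ≡⟨ double X R ⟩
    2 * (X + R)
  ≡⟨ cong (λ t → 2 * (t + R)) (sum-cong-≗ (λ b → sym (*-identityˡ (f zero (suc b))))) ⟩
    2 * (∑ (λ b → 1 * f zero (suc b)) + R)
  ∎
  where
  open ≡-Reasoning
  X = ∑ (λ b → f zero (suc b))
  f′ : Fin n → Fin n → ℕ
  f′ a b = f (suc a) (suc b)
  R = ∑² (λ a b → 𝟙< a b * f′ a b)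
  double : ∀ X R → X + (X + 2 * R) ≡ 2 * (X + R)
  double = solve-∀

module _ {m : ℕ} (E′ : Fin m → Fin m → Bool) (E′-sym : ∀ a b → E′ a b ≡ E′ b a) (E′-irrefl : ∀ a → E′ a a ≡ false) where
  -- the edges inside a set R closed under E′ are counted twice by the degree sum over R
  handshake-closed : ∀ (R : Fin m → Bool) → (∀ a b → T (R a) → T (E′ a b) → T (R b)) →
    2 ∣ ∑ (λ a → 𝟙 (R a) * ∑ (λ b → 𝟙 (E′ a b)))
  handshake-closed R closed = subst (2 ∣_) degree-sum (divides half (trans inner-twice (*-comm 2 half)))
    where
    inner : Fin m → Fin m → ℕ
    inner a b = 𝟙 (R a ∧ (R b ∧ E′ a b))
    half : ℕ
    half = ∑² (λ a b → 𝟙< a b * inner a b)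
    inner-twice : ∑² inner ≡ 2 * half
    inner-twice = ∑²-symmetric inner symmetric diagonal
      where
      symmetric : ∀ a b → inner a b ≡ inner b a
      symmetric a b rewrite E′-sym a b with R a | R b
      ... | true | true = refl
      ... | true | false = refl
      ... | false | true = refl
      ... | false | false = refl
      diagonal : ∀ a → inner a a ≡ 0
      diagonal a rewrite E′-irrefl a with R a
      ... | true = refl
      ... | false = refl
    inner≡ : ∀ a b → inner a b ≡ 𝟙 (R a) * 𝟙 (E′ a b)
    inner≡ a b with R a in ra | E′ a b in e
    ... | false | _ = refl
    ... | true | false with R b
    ...   | true = refl
    ...   | false = refl
    inner≡ a b | true | true with R b in rb | closed a b (subst T (sym ra) tt) (subst T (sym e) tt)
    ...   | true | _ = refl
    degree-sum : ∑² inner ≡ ∑ (λ a → 𝟙 (R a) * ∑ (λ b → 𝟙 (E′ a b)))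
    degree-sum = sum-cong-≗ (λ a → trans (sum-cong-≗ (inner≡ a)) (sym (*-distribˡ-sum (𝟙 (R a)) (λ b → 𝟙 (E′ a b)))))

three-sums-not-all-3-mod-4 : ∀ a b c → (2 + a + b) % 4 ≡ 3 → (2 + a + c) % 4 ≡ 3 → (2 + b + c) % 4 ≡ 3 → ⊥
three-sums-not-all-3-mod-4 a b c e₁ e₂ e₃ = even≢odd (3 + a + b + c) (4 + 2 * (q₁ + q₂ + q₃)) (begin
    2 * (3 + a + b + c)
  ≡⟨ split a b c ⟩
    (2 + a + b) + (2 + a + c) + (2 + b + c)
  ≡⟨ cong₂ _+_ (cong₂ _+_ (≡3+4q (2 + a + b) e₁) (≡3+4q (2 + a + c) e₂)) (≡3+4q (2 + b + c) e₃) ⟩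
    (3 + q₁ * 4) + (3 + q₂ * 4) + (3 + q₃ * 4)
  ≡⟨ regroup q₁ q₂ q₃ ⟩
    suc (2 * (4 + 2 * (q₁ + q₂ + q₃)))
  ∎)
  where
  open ≡-Reasoning
  q₁ = (2 + a + b) / 4
  q₂ = (2 + a + c) / 4
  q₃ = (2 + b + c) / 4
  ≡3+4q : ∀ x → x % 4 ≡ 3 → x ≡ 3 + x / 4 * 4
  ≡3+4q x e = trans (m≡m%n+[m/n]*n x 4) (cong (_+ x / 4 * 4) e)
  split : ∀ a b c → 2 * (3 + a + b + c) ≡ (2 + a + b) + (2 + a + c) + (2 + b + c)
  split = solve-∀
  regroup : ∀ x y z → (3 + x * 4) + (3 + y * 4) + (3 + z * 4) ≡ suc (2 * (4 + 2 * (x + y + z)))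
  regroup = solve-∀

triangular : ℕ → ℕ
triangular zero = 0
triangular (suc q) = suc q + triangular q

Covers : ℕ → List ℕ → Set
Covers q ys = ∀ l → 1 ≤ l → l ≤ q → l ∈ ys

∈-remove : ∀ {x} (A B : List ℕ) {l} → l ∈ A ++ x ∷ B → l ≢ x → l ∈ A ++ B
∈-remove A B {l} p l≢x with ∈-++⁻ A p
... | inj₁ q = ∈-++⁺ˡ q
... | inj₂ (here e) = ⊥-elim (l≢x e)
... | inj₂ (there q) = ∈-++⁺ʳ A q

∈-insert : ∀ {x} (A B : List ℕ) {l} → l ∈ A ++ B → l ∈ A ++ x ∷ B
∈-insert A B p with ∈-++⁻ A p
... | inj₁ q = ∈-++⁺ˡ q
... | inj₂ q = ∈-++⁺ʳ A (there q)

length-insert : ∀ {x} (A B : List ℕ) → length (A ++ x ∷ B) ≡ suc (length (A ++ B))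
length-insert A B = trans (length-++ A) (trans (+-suc _ _) (cong suc (sym (length-++ A))))

Covers-≤ : ∀ {q ys} → Covers (suc q) ys → Covers q ys
Covers-≤ cv l l1 lq = cv l l1 (m≤n⇒m≤1+n lq)

covers⇒≤length : ∀ q ys → Covers q ys → q ≤ length ys
covers⇒≤length zero ys _ = z≤n
covers⇒≤length (suc q) ys cv with ∈-∃++ (cv (suc q) (s≤s z≤n) ≤-refl)
... | A , B , refl = subst (suc q ≤_) (sym (length-insert A B))
      (s≤s (covers⇒≤length q (A ++ B) (λ l l1 lq → ∈-remove A B (Covers-≤ cv l l1 lq) (<⇒≢ (s≤s lq)))))

-- such a list is a permutation of 1, …, q
sum-covering : ∀ q (xs : List ℕ) → length xs ≡ q → (∀ x → x ∈ xs → x ≤ q) → Covers q xs → sum xs ≡ triangular q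
sum-covering zero [] _ _ _ = refl
sum-covering (suc q) xs len bound cv with ∈-∃++ (cv (suc q) (s≤s z≤n) ≤-refl)
... | A , B , refl = begin
      sum (A ++ suc q ∷ B)
    ≡⟨ sum-++ A (suc q ∷ B) ⟩
      sum A + (suc q + sum B)
    ≡⟨ move (sum A) (suc q) (sum B) ⟩
      suc q + (sum A + sum B)
    ≡⟨ cong (suc q +_) (sym (sum-++ A B)) ⟩
      suc q + sum (A ++ B)
    ≡⟨ cong (suc q +_) (sum-covering q (A ++ B) len′ bound′ (λ l l1 lq → ∈-remove A B (Covers-≤ cv l l1 lq) (<⇒≢ (s≤s lq)))) ⟩
      suc q + triangular q
    ∎
  where
  open ≡-Reasoning
  move : ∀ a x b → a + (x + b) ≡ x + (a + b)
  move = solve-∀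
  len′ : length (A ++ B) ≡ q
  len′ = suc-injective (trans (sym (length-insert A B)) len)
  q+1∉ : suc q ∉ A ++ B
  q+1∉ p = <⇒≱ (s≤s ≤-refl) (subst (suc q ≤_) len′ (covers⇒≤length (suc q) (A ++ B) covers))
    where
    covers : Covers (suc q) (A ++ B)
    covers l l1 lq with l ℕ.≟ suc q
    ... | yes refl = p
    ... | no l≢ = ∈-remove A B (cv l l1 lq) l≢
  bound′ : ∀ x → x ∈ A ++ B → x ≤ q
  bound′ x p with x ℕ.≟ suc q
  ... | yes refl = ⊥-elim (q+1∉ p)
  ... | no x≢ = ≤-pred (≤∧≢⇒< (bound x (∈-insert A B p)) x≢)

triangular-even : ∀ q → 2 ∣ triangular q → q % 4 ≡ 0 ⊎ q % 4 ≡ 3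
triangular-even 0 _ = inj₁ refl
triangular-even 1 (divides k e) = ⊥-elim (even≢odd k 0 (sym (trans e (*-comm k 2))))
triangular-even 2 (divides k e) = ⊥-elim (even≢odd k 1 (sym (trans e (*-comm k 2))))
triangular-even 3 _ = inj₂ refl
triangular-even (suc (suc (suc (suc q)))) d =
  subst (λ r → r ≡ 0 ⊎ r ≡ 3) (sym (trans (cong (_% 4) (+-comm 4 q)) ([m+kn]%n≡m%n q 1 4)))
    (triangular-even q (∣m+n∣m⇒∣n (subst (2 ∣_) (unfold q (triangular q)) d) (divides (5 + 2 * q) (even-part q))))
  where
  unfold : ∀ q t → 4 + q + (3 + q + (2 + q + (1 + q + t))) ≡ (10 + 4 * q) + t
  unfold = solve-∀
  even-part : ∀ q → 10 + 4 * q ≡ (5 + 2 * q) * 2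
  even-part = solve-∀

∣m-n∣+2*[m⊓n]≡m+n : ∀ m n → ∣ m - n ∣ + 2 * (m ⊓ n) ≡ m + n
∣m-n∣+2*[m⊓n]≡m+n zero n = +-identityʳ n
∣m-n∣+2*[m⊓n]≡m+n (suc m) zero = refl
∣m-n∣+2*[m⊓n]≡m+n (suc m) (suc n) =
  trans (shift ∣ m - n ∣ (m ⊓ n)) (trans (cong (λ t → suc (suc t)) (∣m-n∣+2*[m⊓n]≡m+n m n)) (sym (cong suc (+-suc m n))))
  where
  shift : ∀ x k → x + 2 * suc k ≡ suc (suc (x + 2 * k))
  shift = solve-∀

3*[4+b]%4 : ∀ b → (3 * (4 + b)) % 4 ≡ (3 * b) % 4
3*[4+b]%4 b = trans (cong (_% 4) (expand b)) ([m+kn]%n≡m%n (3 * b) 3 4)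
  where
  expand : ∀ b → 3 * (4 + b) ≡ 3 * b + 3 * 4
  expand = solve-∀

count-mod-4 : ∀ b → 1 ≤ b → (3 * b) % 4 ≡ 0 ⊎ (3 * b) % 4 ≡ 3 → ∃ λ t → (b ≡ 4 * (t + 1)) ⊎ (b ≡ 4 * t + 1)
count-mod-4 1 _ _ = 0 , inj₂ refl
count-mod-4 2 _ (inj₁ ())
count-mod-4 2 _ (inj₂ ())
count-mod-4 3 _ (inj₁ ())
count-mod-4 3 _ (inj₂ ())
count-mod-4 4 _ _ = 0 , inj₁ refl
count-mod-4 (suc (suc (suc (suc b@(suc _))))) _ m with count-mod-4 b (s≤s z≤n) (subst (λ r → r ≡ 0 ⊎ r ≡ 3) (3*[4+b]%4 b) m)
... | t , inj₁ e = suc t , inj₁ (trans (cong (4 +_) e) (sym (*-suc 4 (t + 1))))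
... | t , inj₂ e = suc t , inj₂ (trans (cong (4 +_) e) (cong (_+ 1) (sym (*-suc 4 t))))

module _ {A : Set} where
  Chain : (A → A → Set) → List A → Set
  Chain R [] = ⊤
  Chain R (x ∷ []) = ⊤
  Chain R (x ∷ y ∷ xs) = R x y × Chain R (y ∷ xs)

  Distinct : List A → Set
  Distinct [] = ⊤
  Distinct (x ∷ xs) = x ∉ xs × Distinct xs

  links : List A → List (A × A)
  links [] = []
  links (x ∷ []) = []
  links (x ∷ y ∷ xs) = (x , y) ∷ links (y ∷ xs)

  closeUp : List A → List A
  closeUp [] = []
  closeUp (h ∷ t) = h ∷ (t ++ h ∷ [])

  cycleLinks : List A → List (A × A)
  cycleLinks L = links (closeUp L)

  Chain⇒links : ∀ {R} L → Chain R L → ∀ {a b} → (a , b) ∈ links L → R a b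
  Chain⇒links (x ∷ y ∷ xs) (r , l) (here refl) = r
  Chain⇒links (x ∷ y ∷ xs) (r , l) (there p) = Chain⇒links (y ∷ xs) l p

  links⇒Chain : ∀ {R} L → (∀ {a b} → (a , b) ∈ links L → R a b) → Chain R L
  links⇒Chain [] h = tt
  links⇒Chain (x ∷ []) h = tt
  links⇒Chain (x ∷ y ∷ xs) h = h (here refl) , links⇒Chain (y ∷ xs) (λ p → h (there p))

  links-split : ∀ xs y ys → links (xs ++ y ∷ ys) ≡ links (xs ++ y ∷ []) ++ links (y ∷ ys)
  links-split [] y ys = refl
  links-split (x ∷ []) y ys = refl
  links-split (x ∷ x′ ∷ xs) y ys = cong ((x , x′) ∷_) (links-split (x′ ∷ xs) y ys)

  links-∈ : ∀ L {a b} → (a , b) ∈ links L → a ∈ L × b ∈ L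
  links-∈ (x ∷ y ∷ xs) (here refl) = here refl , there (here refl)
  links-∈ (x ∷ y ∷ xs) (there p) with links-∈ (y ∷ xs) p
  ... | p₁ , p₂ = there p₁ , there p₂

  links-++⁺ˡ : ∀ L Y {p} → p ∈ links L → p ∈ links (L ++ Y)
  links-++⁺ˡ (x ∷ y ∷ xs) Y (here e) = here e
  links-++⁺ˡ (x ∷ y ∷ xs) Y (there q) = there (links-++⁺ˡ (y ∷ xs) Y q)

  links-++⁺ʳ : ∀ X L {p} → p ∈ links L → p ∈ links (X ++ L)
  links-++⁺ʳ [] L q = q
  links-++⁺ʳ (x ∷ X) L q with X ++ L in eq
  ... | [] = ⊥-elim (noLinks X L eq q)
    where
    noLinks : ∀ X L → X ++ L ≡ [] → ¬ (_ ∈ links L)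
    noLinks [] [] e ()
  ... | z ∷ zs = there (subst (λ w → _ ∈ links w) eq (links-++⁺ʳ X L q))

  Chain-map : ∀ {R R′ : A → A → Set} → (∀ {a b} → R a b → R′ a b) → ∀ L → Chain R L → Chain R′ L
  Chain-map f L l = links⇒Chain L (λ p → f (Chain⇒links L l p))

  Chain-links : ∀ L → Chain (λ a b → (a , b) ∈ links L) L
  Chain-links L = links⇒Chain L (λ p → p)

  Chain-join : ∀ {R} xs y ys → Chain R (xs ++ y ∷ []) → Chain R (y ∷ ys) → Chain R (xs ++ y ∷ ys)
  Chain-join xs y ys l₁ l₂ = links⇒Chain (xs ++ y ∷ ys) h
    where
    h : ∀ {a b} → (a , b) ∈ links (xs ++ y ∷ ys) → _
    h p rewrite links-split xs y ys with ∈-++⁻ (links (xs ++ y ∷ [])) p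
    ... | inj₁ q = Chain⇒links _ l₁ q
    ... | inj₂ q = Chain⇒links _ l₂ q

  Chain-++ˡ : ∀ {R} xs ys → Chain R (xs ++ ys) → Chain R xs
  Chain-++ˡ xs ys l = links⇒Chain xs (λ p → Chain⇒links (xs ++ ys) l (links-++⁺ˡ xs ys p))

  Chain-++ʳ : ∀ {R} xs ys → Chain R (xs ++ ys) → Chain R ys
  Chain-++ʳ xs ys l = links⇒Chain ys (λ p → Chain⇒links (xs ++ ys) l (links-++⁺ʳ xs ys p))

  Chain-reverse : ∀ {R} → (∀ {a b} → R a b → R b a) → ∀ xs → Chain R xs → Chain R (reverse xs)
  Chain-reverse sy [] l = tt
  Chain-reverse sy (x ∷ []) l = tt
  Chain-reverse {R} sy (x ∷ y ∷ xs) (r , l) =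
    subst (Chain R) (sym reverse≡)
      (Chain-join (reverse xs) y (x ∷ [])
        (subst (Chain R) (unfold-reverse y xs) (Chain-reverse sy (y ∷ xs) l)) (sy r , tt))
    where
    reverse≡ : reverse (x ∷ y ∷ xs) ≡ reverse xs ++ y ∷ x ∷ []
    reverse≡ = trans (unfold-reverse x (y ∷ xs))
      (trans (cong (_++ x ∷ []) (unfold-reverse y xs)) (++-assoc (reverse xs) (y ∷ []) (x ∷ [])))

  Distinct-++⁺ : ∀ xs ys → Distinct xs → Distinct ys → Disjoint xs ys → Distinct (xs ++ ys)
  Distinct-++⁺ [] ys _ d₂ _ = d₂
  Distinct-++⁺ (x ∷ xs) ys (x∉xs , d₁) d₂ disj = x∉ , Distinct-++⁺ xs ys d₁ d₂ (λ (p , q) → disj (there p , q))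
    where
    x∉ : x ∉ xs ++ ys
    x∉ p with ∈-++⁻ xs p
    ... | inj₁ q = x∉xs q
    ... | inj₂ q = disj (here refl , q)

  Distinct-++ˡ : ∀ xs ys → Distinct (xs ++ ys) → Distinct xs
  Distinct-++ˡ [] ys _ = tt
  Distinct-++ˡ (x ∷ xs) ys (x∉ , d) = (λ p → x∉ (∈-++⁺ˡ p)) , Distinct-++ˡ xs ys d

  Distinct-++ʳ : ∀ xs ys → Distinct (xs ++ ys) → Distinct ys
  Distinct-++ʳ [] ys d = d
  Distinct-++ʳ (x ∷ xs) ys (_ , d) = Distinct-++ʳ xs ys d

  Distinct-++-disjoint : ∀ xs ys → Distinct (xs ++ ys) → Disjoint xs ys
  Distinct-++-disjoint (x ∷ xs) ys (x∉ , d) (here refl , q) = x∉ (∈-++⁺ʳ xs q)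
  Distinct-++-disjoint (x ∷ xs) ys (x∉ , d) (there p , q) = Distinct-++-disjoint xs ys d (p , q)

  Distinct-reverse : ∀ xs → Distinct xs → Distinct (reverse xs)
  Distinct-reverse [] _ = tt
  Distinct-reverse (x ∷ xs) (x∉ , d) rewrite unfold-reverse x xs =
    Distinct-++⁺ (reverse xs) (x ∷ []) (Distinct-reverse xs d) ((λ ()) , tt)
      (λ { (p , here refl) → x∉ (reverse⁻ p) })

  ∈-rotate : ∀ (X Y : List A) {a} → a ∈ X ++ Y → a ∈ Y ++ X
  ∈-rotate X Y p with ∈-++⁻ X p
  ... | inj₁ q = ∈-++⁺ʳ Y q
  ... | inj₂ q = ∈-++⁺ˡ q

  Distinct-rotate : ∀ (X Y : List A) → Distinct (X ++ Y) → Distinct (Y ++ X)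
  Distinct-rotate X Y d = Distinct-++⁺ Y X (Distinct-++ʳ X Y d) (Distinct-++ˡ X Y d)
    (λ (p , q) → Distinct-++-disjoint X Y d (q , p))

  length-rotate : ∀ (X Y : List A) → length (Y ++ X) ≡ length (X ++ Y)
  length-rotate X Y = trans (length-++ Y) (trans (+-comm (length Y) _) (sym (length-++ X)))

  closeUp-split : ∀ a A′ b B′ → closeUp ((a ∷ A′) ++ (b ∷ B′)) ≡ (a ∷ A′) ++ b ∷ (B′ ++ a ∷ [])
  closeUp-split a A′ b B′ = cong (a ∷_) (++-assoc A′ (b ∷ B′) (a ∷ []))

  cycleLinks-rotate : ∀ X Y {p} → p ∈ cycleLinks (X ++ Y) → p ∈ cycleLinks (Y ++ X)
  cycleLinks-rotate [] Y {p} q = subst (λ w → p ∈ cycleLinks w) (sym (++-identityʳ Y)) q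
  cycleLinks-rotate (a ∷ A′) [] {p} q = subst (λ w → p ∈ cycleLinks w) (++-identityʳ (a ∷ A′)) q
  cycleLinks-rotate (a ∷ A′) (b ∷ B′) {p} q
    rewrite closeUp-split a A′ b B′ | closeUp-split b B′ a A′
          | links-split (a ∷ A′) b (B′ ++ a ∷ []) | links-split (b ∷ B′) a (A′ ++ b ∷ [])
    with ∈-++⁻ (links ((a ∷ A′) ++ b ∷ [])) q
  ... | inj₁ r = ∈-++⁺ʳ (links ((b ∷ B′) ++ a ∷ [])) r
  ... | inj₂ r = ∈-++⁺ˡ r

  sources-cycleLinks : ∀ L → map proj₁ (cycleLinks L) ≡ L
  sources-cycleLinks [] = refl
  sources-cycleLinks (h ∷ t) = sources-links (h ∷ t) h
    where
    sources-links : ∀ xs y → map proj₁ (links (xs ++ y ∷ [])) ≡ xs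
    sources-links [] y = refl
    sources-links (x ∷ []) y = refl
    sources-links (x ∷ x′ ∷ xs) y = cong (x ∷_) (sources-links (x′ ∷ xs) y)

  successor-unique : ∀ L → Distinct L → ∀ {a b b′} → (a , b) ∈ cycleLinks L → (a , b′) ∈ cycleLinks L → b ≡ b′
  successor-unique L d = go (cycleLinks L) (subst Distinct (sym (sources-cycleLinks L)) d)
    where
    go : ∀ (ps : List (A × A)) → Distinct (map proj₁ ps) → ∀ {a b b′} → (a , b) ∈ ps → (a , b′) ∈ ps → b ≡ b′
    go (p ∷ ps) (p∉ , d) (here refl) (here refl) = refl
    go (p ∷ ps) (p∉ , d) (here refl) (there q) = ⊥-elim (p∉ (∈-map⁺ proj₁ q))
    go (p ∷ ps) (p∉ , d) (there q) (here refl) = ⊥-elim (p∉ (∈-map⁺ proj₁ q))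
    go (p ∷ ps) (p∉ , d) (there q) (there q′) = go ps d q q′

  successor-exists : ∀ L {a} → a ∈ L → ∃ λ b → (a , b) ∈ cycleLinks L
  successor-exists L {a} p with ∈-map⁻ proj₁ (subst (a ∈_) (sym (sources-cycleLinks L)) p)
  ... | (a′ , b) , q , refl = b , q

  successor-source : ∀ L {a b} → (a , b) ∈ cycleLinks L → a ∈ L
  successor-source L {a} q = subst (a ∈_) (sources-cycleLinks L) (∈-map⁺ proj₁ q)

concatᶠ : ∀ {A : Set} {k} → (Fin k → List A) → List A
concatᶠ {k = zero} f = []
concatᶠ {k = suc k} f = f zero ++ concatᶠ (λ i → f (suc i))

module _ {A : Set} where
  length-concatᶠ : ∀ {k} (f : Fin k → List A) → length (concatᶠ f) ≡ ∑ (λ i → length (f i))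
  length-concatᶠ {zero} f = refl
  length-concatᶠ {suc k} f = trans (length-++ (f zero)) (cong (length (f zero) +_) (length-concatᶠ (λ i → f (suc i))))

  ∈-concatᶠ⁻ : ∀ {k} (f : Fin k → List A) {x} → x ∈ concatᶠ f → ∃ λ i → x ∈ f i
  ∈-concatᶠ⁻ {suc k} f p with ∈-++⁻ (f zero) p
  ... | inj₁ q = zero , q
  ... | inj₂ q with ∈-concatᶠ⁻ (λ i → f (suc i)) q
  ...   | i , r = suc i , r

  ∈-concatᶠ⁺ : ∀ {k} (f : Fin k → List A) {x} i → x ∈ f i → x ∈ concatᶠ f
  ∈-concatᶠ⁺ f zero q = ∈-++⁺ˡ q
  ∈-concatᶠ⁺ f (suc i) q = ∈-++⁺ʳ (f zero) (∈-concatᶠ⁺ (λ j → f (suc j)) i q)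

sum-concatᶠ : ∀ {k} (f : Fin k → List ℕ) → sum (concatᶠ f) ≡ ∑ (λ i → sum (f i))
sum-concatᶠ {zero} f = refl
sum-concatᶠ {suc k} f = trans (sum-++ (f zero) _) (cong (sum (f zero) +_) (sum-concatᶠ (λ i → f (suc i))))

module _ {X : Set} where
  sum-𝟙-none : ∀ (xs : List X) (p : X → Bool) → (∀ x → x ∈ xs → ¬ T (p x)) → sum (map (λ x → 𝟙 (p x)) xs) ≡ 0
  sum-𝟙-none [] p h = refl
  sum-𝟙-none (x ∷ xs) p h = cong₂ _+_ (𝟙-false (h x (here refl))) (sum-𝟙-none xs p (λ y q → h y (there q)))

  sum-𝟙-unique : ∀ (xs : List X) (p : X → Bool) (R : X → X → Set) → AllPairs (λ a b → ¬ R a b) xs →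
    (∀ a b → a ∈ xs → b ∈ xs → T (p a) → T (p b) → R a b) → ∀ {y} → y ∈ xs → T (p y) →
    sum (map (λ x → 𝟙 (p x)) xs) ≡ 1
  sum-𝟙-unique (x ∷ xs) p R (x≁ ∷ _) related (here refl) py =
    cong₂ _+_ (𝟙-true py) (sum-𝟙-none xs p (λ z q pz → All-lookup x≁ q (related x z (here refl) (there q) py pz)))
  sum-𝟙-unique (x ∷ xs) p R (x≁ ∷ distinct) related (there q) py =
    cong₂ _+_ (𝟙-false (λ px → All-lookup x≁ q (related x _ (here refl) (there q) px py)))
              (sum-𝟙-unique xs p R distinct (λ a b qa qb → related a b (there qa) (there qb)) q py)

  ∑-sum-map : ∀ {k} (xs : List X) (g : X → Fin k → ℕ) → ∑ (λ i → sum (map (λ x → g x i) xs)) ≡ sum (map (λ x → ∑ (g x)) xs)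
  ∑-sum-map {k} [] g = sum-replicate-zero k
  ∑-sum-map (x ∷ xs) g = trans (∑-distrib-+ (g x) (λ i → sum (map (λ y → g y i) xs))) (cong (∑ (g x) +_) (∑-sum-map xs g))

  sum-map-*ʳ : ∀ (xs : List X) (f : X → ℕ) c → sum (map f xs) * c ≡ sum (map (λ x → f x * c) xs)
  sum-map-*ʳ [] f c = refl
  sum-map-*ʳ (x ∷ xs) f c = trans (*-distribʳ-+ c (f x) _) (cong (f x * c +_) (sum-map-*ʳ xs f c))

  sum-map-mod-4 : ∀ (xs : List X) (f : X → ℕ) → (∀ x → x ∈ xs → f x % 4 ≡ 3) → sum (map f xs) % 4 ≡ (3 * length xs) % 4
  sum-map-mod-4 [] f h = refl
  sum-map-mod-4 (x ∷ xs) f h = begin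
      (f x + sum (map f xs)) % 4
    ≡⟨ %-distribˡ-+ (f x) (sum (map f xs)) 4 ⟩
      (f x % 4 + sum (map f xs) % 4) % 4
    ≡⟨ cong₂ (λ a b → (a + b) % 4) (h x (here refl)) (sum-map-mod-4 xs f (λ y q → h y (there q))) ⟩
      (3 + (3 * length xs) % 4) % 4
    ≡⟨ sym (%-distribˡ-+ 3 (3 * length xs) 4) ⟩
      (3 + 3 * length xs) % 4
    ≡⟨ cong (_% 4) (sym (*-suc 3 (length xs))) ⟩
      (3 * suc (length xs)) % 4
    ∎
    where open ≡-Reasoning

module _ {m : ℕ} {S : Fin m → Bool} {E : Fin m → Fin m → Bool} where
  reach-target : ∀ {u w} → Reach S E u w → T (S w)
  reach-target (here s) = s
  reach-target (step _ _ s) = s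

  reach-trans : ∀ {u x w} → Reach S E u x → Reach S E x w → Reach S E u w
  reach-trans r (here _) = r
  reach-trans r (step r′ e s) = step (reach-trans r r′) e s

  reach-edge : ∀ {u w} → T (S u) → T (E u w) → T (S w) → Reach S E u w
  reach-edge su e sw = step (here su) e sw

  reach-sym : (∀ a b → T (E a b) → T (E b a)) → ∀ {u w} → Reach S E u w → Reach S E w u
  reach-sym E-sym (here s) = here s
  reach-sym E-sym (step r e s) = reach-trans (reach-edge s (E-sym _ _ e) (reach-target r)) (reach-sym E-sym r)

reach-edgeless : ∀ {m} {S : Fin m → Bool} {E : Fin m → Fin m → Bool} → (∀ a b → ¬ T (E a b)) →
  ∀ {x a} → Reach S E x a → x ≡ a
reach-edgeless none (here _) = refl
reach-edgeless none (step r e s) = ⊥-elim (none _ _ e)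

reach-first-edge : ∀ {m} {S : Fin m → Bool} {E : Fin m → Fin m → Bool} {x w} → Reach S E x w → x ≢ w → ∃ λ y → T (E x y)
reach-first-edge (here _) x≢w = ⊥-elim (x≢w refl)
reach-first-edge {x = x} (step {x = x′} {w = w} r e s) x≢w with x ≟ x′
... | yes refl = w , e
... | no x≢x′ = reach-first-edge r x≢x′

reach-mono : ∀ {m} {S S′ : Fin m → Bool} {E E′ : Fin m → Fin m → Bool} →
  (∀ x → T (S x) → T (S′ x)) → (∀ a b → T (E a b) → T (E′ a b)) →
  ∀ {u w} → Reach S E u w → Reach S′ E′ u w
reach-mono hs he (here s) = here (hs _ s)
reach-mono hs he (step r e s) = step (reach-mono hs he r) (he _ _ e) (hs _ s)

module ReachDecision {m : ℕ} (S : Fin m → Bool) (E : Fin m → Fin m → Bool) (u : Fin m) where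
  reachableIn : ℕ → Fin m → Bool
  reachableIn zero w = S u ∧ (w == u)
  reachableIn (suc k) w = reachableIn k w ∨ (S w ∧ anyᶠ (λ x → reachableIn k x ∧ E x w))

  reachableIn-sound : ∀ k w → T (reachableIn k w) → Reach S E u w
  reachableIn-sound zero w t with ==⇒≡ {x = w} {u} (T-∧₂ {S u} t)
  ... | refl = here (T-∧₁ t)
  reachableIn-sound (suc k) w t with T-∨-elim {reachableIn k w} t
  ... | inj₁ a = reachableIn-sound k w a
  ... | inj₂ b with anyᶠ-elim (λ x → reachableIn k x ∧ E x w) (T-∧₂ {S w} b)
  ...   | x , p = step (reachableIn-sound k x (T-∧₁ p)) (T-∧₂ {reachableIn k x} p) (T-∧₁ b)

  reachableIn-complete : ∀ {w} → Reach S E u w → ∃ λ k → T (reachableIn k w)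
  reachableIn-complete (here s) = 0 , T-∧-intro s (≡⇒== {x = u} refl)
  reachableIn-complete (step {x = x} {w = w} r e s) with reachableIn-complete r
  ... | k , p = suc k , T-∨₂ {reachableIn k w} (T-∧-intro s (anyᶠ-intro (λ y → reachableIn k y ∧ E y w) x (T-∧-intro p e)))

  reachableIn-+ : ∀ j k w → T (reachableIn k w) → T (reachableIn (j + k) w)
  reachableIn-+ zero k w t = t
  reachableIn-+ (suc j) k w t = T-∨₁ (reachableIn-+ j k w t)

  Stable : ℕ → Set
  Stable k = ∀ w → T (reachableIn (suc k) w) → T (reachableIn k w)

  stable-+ : ∀ k → Stable k → ∀ j w → T (reachableIn (j + k) w) → T (reachableIn k w)
  stable-+ k st zero w t = t
  stable-+ k st (suc j) w t with T-∨-elim {reachableIn (j + k) w} t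
  ... | inj₁ a = stable-+ k st j w a
  ... | inj₂ b with anyᶠ-elim (λ x → reachableIn (j + k) x ∧ E x w) (T-∧₂ {S w} b)
  ...   | x , p = st w (T-∨₂ {reachableIn k w} (T-∧-intro (T-∧₁ b)
                   (anyᶠ-intro (λ y → reachableIn k y ∧ E y w) x
                      (T-∧-intro (stable-+ k st j x (T-∧₁ p)) (T-∧₂ {reachableIn (j + k) x} p)))))

  size : ℕ → ℕ
  size k = ∑ (λ w → 𝟙 (reachableIn k w))

  stable-or-grows : ∀ k → Stable k ⊎ suc (size k) ≤ size (suc k)
  stable-or-grows k with ∃ᶠ-or-∀ᶠ (λ w → reachableIn (suc k) w ∧ not (reachableIn k w))
  ... | inj₁ (w , p) = inj₂ (∑-strict (λ i → 𝟙-mono T-∨₁) w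
                               (new (T-∧₁ p) (T-∧₂ {reachableIn (suc k) w} p)))
    where
    new : ∀ {a b} → T a → T (not b) → 𝟙 b < 𝟙 a
    new {true} {false} _ _ = s≤s z≤n
  ... | inj₂ none = inj₁ (λ w t → old w t (none w))
    where
    old : ∀ w → T (reachableIn (suc k) w) → ¬ T (reachableIn (suc k) w ∧ not (reachableIn k w)) →
          T (reachableIn k w)
    old w t n with reachableIn k w
    ... | true = tt
    ... | false = n (T-∧-intro t tt)

  stable-or-large : ∀ k → (∃ λ j → Stable j) ⊎ (k ≤ size k)
  stable-or-large zero = inj₂ z≤n
  stable-or-large (suc k) with stable-or-large k
  ... | inj₁ p = inj₁ p
  ... | inj₂ le with stable-or-grows k
  ...   | inj₁ st = inj₁ (k , st)
  ...   | inj₂ gr = inj₂ (≤-trans (s≤s le) gr)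

  -- size is bounded by m, so the increasing sets reachableIn k stabilise
  stabilises : ∃ λ j → Stable j
  stabilises with stable-or-large (suc m)
  ... | inj₁ p = p
  ... | inj₂ le = ⊥-elim (<⇒≱ (s≤s ≤-refl) (≤-trans le (∑-≤-size _ (λ w → 𝟙≤1 (reachableIn (suc m) w)))))

  reach? : ∀ w → Dec (Reach S E u w)
  reach? w with stabilises
  ... | j , st with T? (reachableIn j w)
  ...   | yes t = yes (reachableIn-sound j w t)
  ...   | no nt = no (λ r → nt (atStable (reachableIn-complete r)))
    where
    atStable : (∃ λ k → T (reachableIn k w)) → T (reachableIn j w)
    atStable (k , t) with ≤-total k j
    ... | inj₁ k≤j = subst (λ z → T (reachableIn z w)) (m∸n+n≡m k≤j) (reachableIn-+ (j ∸ k) k w t)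
    ... | inj₂ j≤k = stable-+ j st (k ∸ j) w (subst (λ z → T (reachableIn z w)) (sym (m∸n+n≡m j≤k)) t)

open ReachDecision using (reach?)

module _ {m : ℕ} {S : Fin m → Bool} {E : Fin m → Fin m → Bool}
         (E-symmetric : ∀ a b → T (E a b) → T (E b a)) {R : Fin m → Fin m → Set}
         (R⇒E : ∀ {a b} → R a b → T (E a b)) where
  private
    reach-from-head : ∀ h t → Chain R (h ∷ t) → (∀ {a} → a ∈ h ∷ t → T (S a)) → ∀ {a} → a ∈ h ∷ t → Reach S E h a
    reach-from-head h t l s (here refl) = here (s (here refl))
    reach-from-head h (h′ ∷ t) (r , l) s (there q) =
      reach-trans (reach-edge (s (here refl)) (R⇒E r) (s (there (here refl)))) (reach-from-head h′ t l (λ p → s (there p)) q)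

  Chain-reach : ∀ xs → Chain R xs → (∀ {a} → a ∈ xs → T (S a)) → ∀ {a b} → a ∈ xs → b ∈ xs → Reach S E a b
  Chain-reach (h ∷ t) l s pa pb = reach-trans (reach-sym E-symmetric (reach-from-head h t l s pa)) (reach-from-head h t l s pb)

deg : (G : Graph) → Fin (n G) → ℕ
deg G a = ∑ (λ b → 𝟙 (adj G a b))

degree≡deg : ∀ G a → degree G a ≡ deg G a
degree≡deg G a = trans (sum-allFin (λ b → if adj G a b then 1 else 0)) (sum-cong-≗ (λ b → 𝟙-if (adj G a b)))

EdgeUp : (G : Graph) → Fin (n G) → Fin (n G) → Bool
EdgeUp G u v = adj G u v ∧ (toℕ u <ᵇ toℕ v)

numEdges≡∑² : ∀ G → numEdges G ≡ ∑² (λ u v → 𝟙 (EdgeUp G u v))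
numEdges≡∑² G = trans (sum-allFin (λ u → sum (map (λ v → if EdgeUp G u v then 1 else 0) (allFin (n G)))))
  (sum-cong-≗ (λ u → trans (sum-allFin (λ v → if EdgeUp G u v then 1 else 0)) (sum-cong-≗ (λ v → 𝟙-if (EdgeUp G u v)))))

has-neighbour : ∀ G → Connected G → 2 ≤ n G → ∀ x → ∃ λ y → T (adj G x y)
has-neighbour G (_ , conn) two x = reach-first-edge (conn x (proj₁ (other two x)) tt tt) (proj₂ (other two x))
  where
  other : ∀ {k} → 2 ≤ k → (x : Fin k) → ∃ λ w → x ≢ w
  other (s≤s (s≤s z≤n)) zero = suc zero , λ ()
  other (s≤s (s≤s z≤n)) (suc x) = zero , λ ()

module Subgraphs (G : Graph) where
  Vertex : Set
  Vertex = Fin (n G)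

  Adj : Vertex → Vertex → Set
  Adj a b = T (adj G a b)

  adj-sym : ∀ {a b} → Adj a b → Adj b a
  adj-sym {a} {b} p = subst T (adj-sym′ G a b) p

  adj-irrefl : ∀ {a b} → Adj a b → a ≢ b
  adj-irrefl {a} p refl = subst T (irrefl G a) p

  _∈?_ : (x : Vertex) (xs : List Vertex) → Dec (x ∈ xs)
  _∈?_ = DecMembership._∈?_ _≟_

  _∈²?_ : (p : Vertex × Vertex) (ps : List (Vertex × Vertex)) → Dec (p ∈ ps)
  _∈²?_ = DecMembership._∈?_ (≡-dec _≟_ _≟_)

  -- A cycle is its list of vertices in cyclic order; its edges are the cycleLinks read in either direction.
  record IsCycle (cs : List Vertex) : Set where
    constructor isCycle
    field
      distinct : Distinct cs
      chain    : Chain Adj (closeUp cs)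
      long     : 3 ≤ length cs
  open IsCycle public

  CycleEdge : List Vertex → Vertex → Vertex → Set
  CycleEdge cs u v = (u , v) ∈ cycleLinks cs ⊎ (v , u) ∈ cycleLinks cs

  cycleEdge? : ∀ cs u v → Dec (CycleEdge cs u v)
  cycleEdge? cs u v with (u , v) ∈²? cycleLinks cs | (v , u) ∈²? cycleLinks cs
  ... | yes p | _ = yes (inj₁ p)
  ... | no _ | yes q = yes (inj₂ q)
  ... | no p | no q = no λ { (inj₁ a) → p a ; (inj₂ b) → q b }

  CycleEdge-sym : ∀ {cs u v} → CycleEdge cs u v → CycleEdge cs v u
  CycleEdge-sym (inj₁ p) = inj₂ p
  CycleEdge-sym (inj₂ p) = inj₁ p

  ∈-closeUp : ∀ (L : List Vertex) {a} → a ∈ closeUp L → a ∈ L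
  ∈-closeUp (h ∷ t) (here e) = here e
  ∈-closeUp (h ∷ t) (there p) with ∈-++⁻ t p
  ... | inj₁ q = there q
  ... | inj₂ (here e) = here e

  CycleEdge-ends : ∀ cs {u v} → CycleEdge cs u v → u ∈ cs × v ∈ cs
  CycleEdge-ends cs (inj₁ p) with links-∈ (closeUp cs) p
  ... | a , b = ∈-closeUp cs a , ∈-closeUp cs b
  CycleEdge-ends cs (inj₂ p) with links-∈ (closeUp cs) p
  ... | a , b = ∈-closeUp cs b , ∈-closeUp cs a

  CycleEdge-adj : ∀ cs → IsCycle cs → ∀ {u v} → CycleEdge cs u v → Adj u v
  CycleEdge-adj cs c (inj₁ p) = Chain⇒links (closeUp cs) (chain c) p
  CycleEdge-adj cs c (inj₂ p) = adj-sym (Chain⇒links (closeUp cs) (chain c) p)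

  CycleEdge-rotate : ∀ X Y {u v} → CycleEdge (X ++ Y) u v → CycleEdge (Y ++ X) u v
  CycleEdge-rotate X Y (inj₁ p) = inj₁ (cycleLinks-rotate X Y p)
  CycleEdge-rotate X Y (inj₂ p) = inj₂ (cycleLinks-rotate X Y p)

  IsCycle-rotate : ∀ X Y → IsCycle (X ++ Y) → IsCycle (Y ++ X)
  IsCycle-rotate X Y (isCycle d l len) = isCycle
    (Distinct-rotate X Y d)
    (links⇒Chain (closeUp (Y ++ X)) (λ p → Chain⇒links (closeUp (X ++ Y)) l (cycleLinks-rotate Y X p)))
    (subst (3 ≤_) (sym (length-rotate X Y)) len)

  links⊆cycleLinks : ∀ (cs : List Vertex) {p} → p ∈ links cs → p ∈ cycleLinks cs
  links⊆cycleLinks (h ∷ t) q = links-++⁺ˡ (h ∷ t) (h ∷ []) q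

  cycleSubgraph : ∀ cs → IsCycle cs → Subgraph G
  cycleSubgraph cs c = record
    { V = λ u → ⌊ u ∈? cs ⌋
    ; E = λ u v → ⌊ cycleEdge? cs u v ⌋
    ; E-sym = λ u v → T-injective (λ t → fromWitness (CycleEdge-sym (toWitness t)))
                          (λ t → fromWitness (CycleEdge-sym (toWitness t)))
    ; E-adj = λ u v t → CycleEdge-adj cs c (toWitness {a? = cycleEdge? cs u v} t)
    ; E-ends = λ u v t → let e = CycleEdge-ends cs (toWitness {a? = cycleEdge? cs u v} t) in
                          fromWitness (proj₁ e) , fromWitness (proj₂ e)
    }

  toCycle : ∀ cs → IsCycle cs → Cycle G (length cs)
  toCycle (a ∷ b ∷ c ∷ xs) (isCycle d l _) = record
    { m = length xs
    ; len = refl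
    ; c = lookup (a ∷ b ∷ c ∷ xs)
    ; c-inj = λ {i} {j} e → lookup-injective (a ∷ b ∷ c ∷ xs) d i j e
    ; c-step = Chain-lookup a (b ∷ c ∷ xs) (Chain-++ˡ (a ∷ b ∷ c ∷ xs) (a ∷ []) l)
    ; c-close = Chain-last a (b ∷ c ∷ xs) a l
    }
    where
    Chain-lookup : ∀ x xs → Chain Adj (x ∷ xs) → (i : Fin (length xs)) →
                   Adj (lookup (x ∷ xs) (inject₁ i)) (lookup (x ∷ xs) (suc i))
    Chain-lookup x (y ∷ ys) (r , l) zero = r
    Chain-lookup x (y ∷ ys) (r , l) (suc i) = Chain-lookup y ys l i
    Chain-last : ∀ x xs y → Chain Adj (x ∷ xs ++ y ∷ []) → Adj (lookup (x ∷ xs) (fromℕ (length xs))) y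
    Chain-last x [] y (r , _) = r
    Chain-last x (z ∷ zs) y (_ , l) = Chain-last z zs y l
    lookup-injective : ∀ xs → Distinct xs → ∀ i j → lookup xs i ≡ lookup xs j → i ≡ j
    lookup-injective (x ∷ xs) d zero zero e = refl
    lookup-injective (x ∷ xs) (x∉ , d) zero (suc j) e = ⊥-elim (x∉ (subst (_∈ xs) (sym e) (∈-lookup j)))
    lookup-injective (x ∷ xs) (x∉ , d) (suc i) zero e = ⊥-elim (x∉ (subst (_∈ xs) e (∈-lookup i)))
    lookup-injective (x ∷ xs) (x∉ , d) (suc i) (suc j) e = cong suc (lookup-injective xs d i j e)
  toCycle (a ∷ b ∷ []) (isCycle _ _ (s≤s (s≤s ())))
  toCycle (a ∷ []) (isCycle _ _ (s≤s ()))
  toCycle [] (isCycle _ _ ())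

  E-symmetric : ∀ (H : Subgraph G) a b → T (E H a b) → T (E H b a)
  E-symmetric H a b = subst T (E-sym H a b)

  cycleSubgraph-connected : ∀ cs (c : IsCycle cs) → ConnectedSub {G} (cycleSubgraph cs c)
  cycleSubgraph-connected (h ∷ t) c = (h , fromWitness (here refl)) ,
    λ u w su sw → Chain-reach (E-symmetric H) (λ p → fromWitness (inj₁ (links⊆cycleLinks (h ∷ t) p)))
      (h ∷ t) (Chain-links (h ∷ t)) fromWitness (toWitness su) (toWitness sw)
    where
    H = cycleSubgraph (h ∷ t) c
  cycleSubgraph-connected [] (isCycle _ _ ())

  V-without : Subgraph G → Vertex → Vertex → Bool
  V-without H z x = V H x ∧ not (x == z)

  V-without-intro : ∀ H {z x} → T (V H x) → x ≢ z → T (V-without H z x)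
  V-without-intro H vx ne = T-∧-intro vx (T-not (λ t → ne (==⇒≡ t)))

  V-without-V : ∀ H {z x} → T (V-without H z x) → T (V H x)
  V-without-V H t = T-∧₁ t

  V-without-≢ : ∀ H {z x} → T (V-without H z x) → x ≢ z
  V-without-≢ H {z} {x} t e = T-not⁻ (T-∧₂ {V H x} t) (≡⇒== e)

  noCutVertex-intro : ∀ H → (∀ z u w → T (V-without H z u) → T (V-without H z w) → Reach (V-without H z) (E H) u w) →
    NoCutVertex {G} H
  noCutVertex-intro H f z (_ , u , w , su , sw , nr) = nr (f z u w su sw)

  noCutVertex-reach : ∀ H → ConnectedSub {G} H → NoCutVertex {G} H → ∀ z u w →
    T (V H u) → T (V H w) → u ≢ z → w ≢ z → Reach (V-without H z) (E H) u w
  noCutVertex-reach H (_ , conn) nc z u w vu vw u≢z w≢z with T? (V H z)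
  ... | no z∉H = reach-mono (λ x vx → V-without-intro H vx (λ e → z∉H (subst (λ y → T (V H y)) e vx))) (λ a b e → e)
                   (conn u w vu vw)
  ... | yes z∈H with reach? (V-without H z) (E H) u w
  ...   | yes r = r
  ...   | no nr = ⊥-elim (nc z (z∈H , u , w , V-without-intro H vu u≢z , V-without-intro H vw w≢z , nr))

  cycleSubgraph-noCutVertex : ∀ cs (c : IsCycle cs) → NoCutVertex {G} (cycleSubgraph cs c)
  cycleSubgraph-noCutVertex cs c = noCutVertex-intro H reach-avoiding
    where
    H = cycleSubgraph cs c
    reach-avoiding : ∀ z u w → T (V-without H z u) → T (V-without H z w) → Reach (V-without H z) (E H) u w
    reach-avoiding z u w su sw with z ∈? cs
    ... | no z∉cs = Chain-reach (E-symmetric H) (λ p → fromWitness (inj₁ (links⊆cycleLinks cs p))) cs (Chain-links cs)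
        (λ q → V-without-intro H (fromWitness q) (λ e → z∉cs (subst (_∈ cs) e q)))
        (toWitness (V-without-V H su)) (toWitness (V-without-V H sw))
    ... | yes z∈cs with ∈-∃++ z∈cs
    ...   | X , Y , refl = Chain-reach (E-symmetric H) link-edge P (Chain-links P) P⊆ (toP u su) (toP w sw)
      where
      -- removing z from the cycle X ++ z ∷ Y leaves the path Y ++ X
      P : List Vertex
      P = Y ++ X
      link-edge : ∀ {a b} → (a , b) ∈ links P → T (E H a b)
      link-edge q = fromWitness (inj₁ (cycleLinks-rotate (z ∷ Y) X (links-++⁺ʳ (z ∷ []) (P ++ z ∷ []) (links-++⁺ˡ P (z ∷ []) q))))
      z∉P : z ∉ P
      z∉P = proj₁ (Distinct-rotate X (z ∷ Y) (distinct c))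
      P⊆ : ∀ {a} → a ∈ P → T (V-without H z a)
      P⊆ q = V-without-intro H (fromWitness (∈-rotate (z ∷ Y) X (there q))) (λ e → z∉P (subst (_∈ P) e q))
      toP : ∀ a → T (V-without H z a) → a ∈ P
      toP a t with ∈-rotate X (z ∷ Y) (toWitness (V-without-V H t))
      ... | here e = ⊥-elim (V-without-≢ H t e)
      ... | there q = q

  module _ {S : Vertex → Bool} {E′ : Vertex → Vertex → Bool} (cs : List Vertex) where
    reach-exits : ∀ {a w} → Reach S E′ a w → a ∈ cs → w ∉ cs →
      ∃₂ λ x y → x ∈ cs × y ∉ cs × T (E′ x y) × T (S y)
    reach-exits (here _) a∈ w∉ = ⊥-elim (w∉ a∈)
    reach-exits (step {x = x} r e s) a∈ w∉ with x ∈? cs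
    ... | yes x∈ = x , _ , x∈ , w∉ , e , s
    ... | no x∉ = reach-exits r a∈ x∉

  EndsAt : List Vertex → Vertex → Set
  EndsAt [] y = ⊥
  EndsAt (a ∷ []) y = a ≡ y
  EndsAt (a ∷ b ∷ L) y = EndsAt (b ∷ L) y

  EndsAt-++ʳ : ∀ P L {y} → EndsAt (P ++ L) y → EndsAt L y ⊎ L ≡ []
  EndsAt-++ʳ P [] e = inj₂ refl
  EndsAt-++ʳ [] (l ∷ L) e = inj₁ e
  EndsAt-++ʳ (p ∷ []) (l ∷ L) e = inj₁ e
  EndsAt-++ʳ (p ∷ p′ ∷ P) (l ∷ L) e = EndsAt-++ʳ (p′ ∷ P) (l ∷ L) e

  EndsAt-∷ : ∀ z L {y} → EndsAt L y → EndsAt (z ∷ L) y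
  EndsAt-∷ z (l ∷ L) e = e

  EndsAt⇒snoc : ∀ L {y} → EndsAt L y → ∃ λ L′ → L ≡ L′ ++ y ∷ []
  EndsAt⇒snoc (a ∷ []) refl = [] , refl
  EndsAt⇒snoc (a ∷ b ∷ L) e with EndsAt⇒snoc (b ∷ L) e
  ... | L′ , eq = a ∷ L′ , cong (a ∷_) eq

  Chain-snoc : ∀ {R : Vertex → Vertex → Set} L {y x} → Chain R L → EndsAt L y → R y x → Chain R (L ++ x ∷ [])
  Chain-snoc (a ∷ []) l refl r = r , tt
  Chain-snoc (a ∷ b ∷ L) (r′ , l) e r = r′ , Chain-snoc (b ∷ L) l e r

  -- Cutting the loops out of a walk from y; the resulting paths are listed backwards, ending at y.
  module _ {S : Vertex → Bool} {E′ : Vertex → Vertex → Bool} (E′-sym : ∀ a b → T (E′ a b) → T (E′ b a))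
           (cs : List Vertex) (y : Vertex) where
    private
      Path : List Vertex → Set
      Path L = Chain (λ a b → T (E′ a b)) L

    data SimplePathTo (w : Vertex) : Set where
      enters : ∀ z L → z ∈ cs → T (S z) → Path (z ∷ L) → EndsAt L y → Distinct L → (∀ {a} → a ∈ L → a ∉ cs) →
               SimplePathTo w
      avoids : ∀ K → Path (w ∷ K) → EndsAt (w ∷ K) y → Distinct (w ∷ K) → (∀ {a} → a ∈ w ∷ K → a ∉ cs) →
               SimplePathTo w

    simplify : ∀ {w} → y ∉ cs → Reach S E′ y w → SimplePathTo w
    simplify y∉ (here s) = avoids [] tt refl ((λ ()) , tt) λ { (here refl) → y∉ }
    simplify y∉ (step {x = x} {w = w} r e s) with simplify y∉ r
    ... | enters z L z∈ sz p en d out = enters z L z∈ sz p en d out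
    ... | avoids K p en d out with w ∈? cs
    ...   | yes w∈ = enters w (x ∷ K) w∈ s (E′-sym x w e , p) en d out
    ...   | no w∉ with w ∈? (x ∷ K)
    ...     | no w∉K = avoids (x ∷ K) (E′-sym x w e , p) en (w∉K , d) λ { (here refl) → w∉ ; (there q) → out q }
    ...     | yes w∈K with ∈-∃++ w∈K
    ...       | P , Q , eq = avoids Q (Chain-++ʳ P (w ∷ Q) (subst Path eq p))
                   (nonempty (EndsAt-++ʳ P (w ∷ Q) (subst (λ l → EndsAt l y) eq en)))
                   (Distinct-++ʳ P (w ∷ Q) (subst Distinct eq d))
                   (λ q → out (subst (_ ∈_) (sym eq) (∈-++⁺ʳ P q)))
      where
      nonempty : EndsAt (w ∷ Q) y ⊎ (w ∷ Q) ≡ [] → EndsAt (w ∷ Q) y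
      nonempty (inj₁ e) = e

  length-∷-++-∷ : ∀ (x : Vertex) A w I → length (x ∷ A ++ w ∷ I) ≡ 2 + (length A + length I)
  length-∷-++-∷ x A w I = cong suc (trans (length-++ A) (+-suc _ _))

  replace-arc : ∀ x A z B I → IsCycle (x ∷ A ++ z ∷ B) → Distinct I → Disjoint I (x ∷ A ++ z ∷ B) →
    Chain Adj (z ∷ I ++ x ∷ []) → 1 ≤ length A + length I → IsCycle (x ∷ A ++ z ∷ I)
  replace-arc x A z B I (isCycle d l _) dI disj ear nonempty = isCycle d′ l′ len′
    where
    prefix≡ : x ∷ A ++ z ∷ B ≡ (x ∷ A ++ z ∷ []) ++ B
    prefix≡ = cong (x ∷_) (sym (++-assoc A (z ∷ []) B))
    d′ : Distinct (x ∷ A ++ z ∷ I)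
    d′ = subst Distinct (cong (x ∷_) (++-assoc A (z ∷ []) I))
           (Distinct-++⁺ (x ∷ A ++ z ∷ []) I (Distinct-++ˡ _ B (subst Distinct prefix≡ d)) dI
              (λ {v} (p , q) → disj (q , subst (v ∈_) (sym prefix≡) (∈-++⁺ˡ p))))
    closeUp≡ : closeUp (x ∷ A ++ z ∷ B) ≡ (x ∷ A ++ z ∷ []) ++ (B ++ x ∷ [])
    closeUp≡ = cong (x ∷_) (trans (++-assoc A (z ∷ B) (x ∷ [])) (sym (++-assoc A (z ∷ []) (B ++ x ∷ []))))
    l′ : Chain Adj (closeUp (x ∷ A ++ z ∷ I))
    l′ = subst (Chain Adj) (cong (x ∷_) (sym (++-assoc A (z ∷ I) (x ∷ []))))
           (Chain-join (x ∷ A) z (I ++ x ∷ [])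
              (Chain-++ˡ (x ∷ A ++ z ∷ []) (B ++ x ∷ []) (subst (Chain Adj) closeUp≡ l)) ear)
    len′ : 3 ≤ length (x ∷ A ++ z ∷ I)
    len′ = subst (3 ≤_) (sym (length-∷-++-∷ x A z I)) (s≤s (s≤s nonempty))

  edgeCount : Subgraph G → ℕ
  edgeCount H = ∑² (λ u v → 𝟙 (E H u v) * 𝟙< u v)

  edgeCount-≈ : ∀ A B → _≈_ {G} A B → edgeCount A ≡ edgeCount B
  edgeCount-≈ A B ((_ , A⊆B) , (_ , B⊆A)) =
    sum-cong-≗ (λ u → sum-cong-≗ (λ v → cong (λ t → 𝟙 t * 𝟙< u v) (T-injective (A⊆B u v) (B⊆A u v))))

  Link : List Vertex → Vertex → Vertex → Bool
  Link cs u v = ⌊ (u , v) ∈²? cycleLinks cs ⌋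

  cycleLinks-asymmetric : ∀ cs → IsCycle cs → ∀ {u v} → (u , v) ∈ cycleLinks cs → (v , u) ∈ cycleLinks cs → ⊥
  cycleLinks-asymmetric cs c {u} {v} p q with ∈-∃++ (successor-source cs p)
  ... | X , Y , refl = at-head (Y ++ X) (IsCycle-rotate X (u ∷ Y) c) (cycleLinks-rotate X (u ∷ Y) p) (cycleLinks-rotate X (u ∷ Y) q)
    where
    at-head : ∀ R → IsCycle (u ∷ R) → (u , v) ∈ cycleLinks (u ∷ R) → (v , u) ∈ cycleLinks (u ∷ R) → ⊥
    at-head (r₁ ∷ r₂ ∷ R) c′ p′ q′ with successor-unique (u ∷ r₁ ∷ r₂ ∷ R) (distinct c′) p′ (here refl)
    ... | refl with successor-unique (u ∷ r₁ ∷ r₂ ∷ R) (distinct c′) q′ (there (here refl))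
    ...   | refl = proj₁ (distinct c′) (there (here refl))
    at-head (r₁ ∷ []) (isCycle _ _ (s≤s (s≤s ()))) p′ q′
    at-head [] (isCycle _ _ (s≤s ())) p′ q′

  𝟙-cycleEdge : ∀ cs → IsCycle cs → ∀ u v → 𝟙 ⌊ cycleEdge? cs u v ⌋ ≡ 𝟙 (Link cs u v) + 𝟙 (Link cs v u)
  𝟙-cycleEdge cs c u v with (u , v) ∈²? cycleLinks cs | (v , u) ∈²? cycleLinks cs
  ... | yes p | yes q = ⊥-elim (cycleLinks-asymmetric cs c p q)
  ... | yes p | no _ = refl
  ... | no _ | yes q = refl
  ... | no _ | no _ = refl

  out-degree-Link : ∀ cs → Distinct cs → ∀ u → ∑ (λ v → 𝟙 (Link cs u v)) ≡ 𝟙 ⌊ u ∈? cs ⌋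
  out-degree-Link cs d u with u ∈? cs
  ... | no u∉ = ∑-zero (λ v → 𝟙 (Link cs u v)) (λ v → 𝟙-false (λ t → u∉ (successor-source cs (toWitness t))))
  ... | yes u∈ with successor-exists cs u∈
  ...   | s , q = trans (∑-single (λ v → 𝟙 (Link cs u v)) s (λ v v≢s → 𝟙-false (λ t → v≢s (successor-unique cs d (toWitness t) q))))
                        (𝟙-true (fromWitness q))

  ∑-𝟙-∈ : ∀ cs → Distinct cs → ∑ (λ u → 𝟙 ⌊ u ∈? cs ⌋) ≡ length cs
  ∑-𝟙-∈ [] _ = ∑-zero (λ u → 𝟙 ⌊ u ∈? [] ⌋) (λ u → refl)
  ∑-𝟙-∈ (x ∷ xs) (x∉ , d) = begin
      ∑ (λ u → 𝟙 ⌊ u ∈? (x ∷ xs) ⌋)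
    ≡⟨ sum-cong-≗ split ⟩
      ∑ (λ u → 𝟙 (u == x) + 𝟙 ⌊ u ∈? xs ⌋)
    ≡⟨ ∑-distrib-+ (λ u → 𝟙 (u == x)) (λ u → 𝟙 ⌊ u ∈? xs ⌋) ⟩
      ∑ (λ u → 𝟙 (u == x)) + ∑ (λ u → 𝟙 ⌊ u ∈? xs ⌋)
    ≡⟨ cong₂ _+_ (∑-𝟙-==ˡ x) (∑-𝟙-∈ xs d) ⟩
      suc (length xs)
    ∎
    where
    open ≡-Reasoning
    split : ∀ u → 𝟙 ⌊ u ∈? (x ∷ xs) ⌋ ≡ 𝟙 (u == x) + 𝟙 ⌊ u ∈? xs ⌋
    split u = cases (u ≟ x) (u ∈? xs)
      where
      u∈? : Dec (u ∈ x ∷ xs)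
      u∈? = u ∈? (x ∷ xs)
      cases : Dec (u ≡ x) → Dec (u ∈ xs) → 𝟙 ⌊ u∈? ⌋ ≡ 𝟙 (u == x) + 𝟙 ⌊ u ∈? xs ⌋
      cases (yes refl) _ = trans (𝟙-true (fromWitness {a? = u∈?} (here refl)))
                                 (sym (cong₂ _+_ (𝟙-==-refl u) (𝟙-false (λ t → x∉ (toWitness t)))))
      cases (no u≢x) (yes u∈) = trans (𝟙-true (fromWitness {a? = u∈?} (there u∈)))
                                      (sym (cong₂ _+_ (𝟙-==-≢ u≢x) (𝟙-true (fromWitness {a? = u ∈? xs} u∈))))
      cases (no u≢x) (no u∉) = trans (𝟙-false (λ t → [ u≢x , u∉ ]′ (toSum (toWitness {a? = u∈?} t))))
                                     (sym (cong₂ _+_ (𝟙-==-≢ u≢x) (𝟙-false (λ t → u∉ (toWitness t)))))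

  -- each vertex of a cycle has exactly one successor, and every edge is one link read in one of two directions
  edgeCount-cycleSubgraph : ∀ cs (c : IsCycle cs) → edgeCount (cycleSubgraph cs c) ≡ length cs
  edgeCount-cycleSubgraph cs c =
    trans (sum-cong-≗ (λ u → sum-cong-≗ (λ v → *-comm (𝟙 (E H u v)) (𝟙< u v))))
      (*-cancelˡ-≡ _ (length cs) 2 (trans (sym (∑²-symmetric (λ u v → 𝟙 (E H u v)) (λ u v → cong 𝟙 (E-sym H u v))
                                                                  (λ u → 𝟙-false (λ t → adj-irrefl (E-adj H u u t) refl))))
                                            twice))
    where
    open ≡-Reasoning
    H = cycleSubgraph cs c
    links-count : ∑² (λ u v → 𝟙 (Link cs u v)) ≡ length cs
    links-count = trans (sum-cong-≗ (out-degree-Link cs (distinct c))) (∑-𝟙-∈ cs (distinct c))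
    twice : ∑² (λ u v → 𝟙 (E H u v)) ≡ 2 * length cs
    twice = begin
        ∑² (λ u v → 𝟙 (E H u v))
      ≡⟨ sum-cong-≗ (λ u → trans (sum-cong-≗ (𝟙-cycleEdge cs c u)) (∑-distrib-+ (λ v → 𝟙 (Link cs u v)) (λ v → 𝟙 (Link cs v u)))) ⟩
        ∑ (λ u → ∑ (λ v → 𝟙 (Link cs u v)) + ∑ (λ v → 𝟙 (Link cs v u)))
      ≡⟨ ∑-distrib-+ (λ u → ∑ (λ v → 𝟙 (Link cs u v))) (λ u → ∑ (λ v → 𝟙 (Link cs v u))) ⟩
        ∑² (λ u v → 𝟙 (Link cs u v)) + ∑² (λ u v → 𝟙 (Link cs v u))
      ≡⟨ cong (∑² (λ u v → 𝟙 (Link cs u v)) +_) (∑-comm (λ u v → 𝟙 (Link cs v u))) ⟩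
        ∑² (λ u v → 𝟙 (Link cs u v)) + ∑² (λ u v → 𝟙 (Link cs u v))
      ≡⟨ cong (λ t → t + t) links-count ⟩
        length cs + length cs
      ≡⟨ cong (length cs +_) (sym (+-identityʳ (length cs))) ⟩
        2 * length cs
      ∎

  ⊑-trans : ∀ {A B C : Subgraph G} → _⊑_ {G} A B → _⊑_ {G} B C → _⊑_ {G} A C
  ⊑-trans (v₁ , e₁) (v₂ , e₂) = (λ x t → v₂ x (v₁ x t)) , (λ a b t → e₂ a b (e₁ a b t))

  _∪_ : Subgraph G → Subgraph G → Subgraph G
  B ∪ C = record
    { V = λ x → V B x ∨ V C x
    ; E = λ a b → E B a b ∨ E C a b
    ; E-sym = λ a b → cong₂ _∨_ (E-sym B a b) (E-sym C a b)
    ; E-adj = λ a b t → [ E-adj B a b , E-adj C a b ]′ (T-∨-elim {E B a b} t)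
    ; E-ends = λ a b t → [ (λ e → T-∨₁ (proj₁ (E-ends B a b e)) , T-∨₁ (proj₂ (E-ends B a b e)))
                         , (λ e → T-∨₂ {V B a} (proj₁ (E-ends C a b e)) , T-∨₂ {V B b} (proj₂ (E-ends C a b e))) ]′
                         (T-∨-elim {E B a b} t)
    }

  ⊑-∪ˡ : ∀ B C → _⊑_ {G} B (B ∪ C)
  ⊑-∪ˡ B C = (λ x → T-∨₁) , (λ a b → T-∨₁)

  ⊑-∪ʳ : ∀ B C → _⊑_ {G} C (B ∪ C)
  ⊑-∪ʳ B C = (λ x → T-∨₂ {V B x}) , (λ a b → T-∨₂ {E B a b})

  module _ (B C : Subgraph G) (B-block : IsBlock {G} B) (C-block : IsBlock {G} C) where
    ∪-connected : ∀ {s} → T (V B s) → T (V C s) → ConnectedSub {G} (B ∪ C)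
    ∪-connected {s} bs cs = (s , T-∨₁ bs) , λ a b ta tb → reach-trans (to-s a ta) (reach-sym (E-symmetric (B ∪ C)) (to-s b tb))
      where
      to-s : ∀ a → T (V (B ∪ C) a) → Reach (V (B ∪ C)) (E (B ∪ C)) a s
      to-s a t with T-∨-elim {V B a} t
      ... | inj₁ ba = reach-mono (proj₁ (⊑-∪ˡ B C)) (proj₂ (⊑-∪ˡ B C)) (proj₂ (proj₁ B-block) a s ba bs)
      ... | inj₂ ca = reach-mono (proj₁ (⊑-∪ʳ B C)) (proj₂ (⊑-∪ʳ B C)) (proj₂ (proj₁ C-block) a s ca cs)

    -- any vertex z is avoided by one of the two shared vertices, through which B ∪ C - z stays connected
    ∪-noCutVertex : ∀ {u v} → u ≢ v → T (V B u) → T (V B v) → T (V C u) → T (V C v) → NoCutVertex {G} (B ∪ C)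
    ∪-noCutVertex {u} {v} u≢v bu bv cu cv = noCutVertex-intro (B ∪ C) reach-avoiding
      where
      U = B ∪ C
      reach-avoiding : ∀ z a b → T (V-without U z a) → T (V-without U z b) → Reach (V-without U z) (E U) a b
      reach-avoiding z a b ta tb = reach-trans (to-s a ta) (reach-sym (E-symmetric U) (to-s b tb))
        where
        shared : Σ Vertex λ s → T (V B s) × T (V C s) × s ≢ z
        shared with u ≟ z
        ... | yes refl = v , bv , cv , (λ e → u≢v (sym e))
        ... | no u≢z = u , bu , cu , u≢z
        s = proj₁ shared
        to-s : ∀ a → T (V-without U z a) → Reach (V-without U z) (E U) a s
        to-s a t with T-∨-elim {V B a} (V-without-V U t)
        ... | inj₁ ba = reach-mono (λ x tx → V-without-intro U (T-∨₁ (V-without-V B tx)) (V-without-≢ B tx)) (λ a b → T-∨₁)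
                (noCutVertex-reach B (proj₁ B-block) (proj₁ (proj₂ B-block)) z a s ba (proj₁ (proj₂ shared))
                   (V-without-≢ U t) (proj₂ (proj₂ (proj₂ shared))))
        ... | inj₂ ca = reach-mono (λ x tx → V-without-intro U (T-∨₂ {V B x} (V-without-V C tx)) (V-without-≢ C tx))
                (λ a b → T-∨₂ {E B a b})
                (noCutVertex-reach C (proj₁ C-block) (proj₁ (proj₂ C-block)) z a s ca (proj₁ (proj₂ (proj₂ shared)))
                   (V-without-≢ U t) (proj₂ (proj₂ (proj₂ shared))))

    blocks-sharing-two-vertices : ∀ {u v} → u ≢ v → T (V B u) → T (V B v) → T (V C u) → T (V C v) → _≈_ {G} B C
    blocks-sharing-two-vertices u≢v bu bv cu cv = B⊑C , C⊑B
      where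
      U⊑ : ∀ {D} → IsBlock {G} D → _⊑_ {G} D (B ∪ C) → _⊑_ {G} (B ∪ C) D
      U⊑ (_ , _ , maximal) = maximal (B ∪ C) (∪-connected bu cu) (∪-noCutVertex u≢v bu bv cu cv)
      C⊑B : _⊑_ {G} C B
      C⊑B = ⊑-trans {C} {B ∪ C} {B} (⊑-∪ʳ B C) (U⊑ {B} B-block (⊑-∪ˡ B C))
      B⊑C : _⊑_ {G} B C
      B⊑C = ⊑-trans {B} {B ∪ C} {C} (⊑-∪ˡ B C) (U⊑ {C} C-block (⊑-∪ʳ B C))

module Eps3 (G : Graph) (cycles≡3 : ∀ k → Cycle G k → k % 4 ≡ 3) where
  open Subgraphs G

  cycle-length : ∀ cs → IsCycle cs → length cs % 4 ≡ 3
  cycle-length cs c = cycles≡3 (length cs) (toCycle cs c)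

  no-theta-arcs : ∀ x A z B I → IsCycle (x ∷ A ++ z ∷ B) → Distinct I → Disjoint I (x ∷ A ++ z ∷ B) →
    Chain Adj (z ∷ I ++ x ∷ []) → (I ≡ [] → ¬ CycleEdge (x ∷ A ++ z ∷ B) x z) → ⊥
  no-theta-arcs x A z B I c dI disj ear not-edge =
    three-sums-not-all-3-mod-4 (length A) (length B) (length I)
      (subst (λ k → k % 4 ≡ 3) (length-∷-++-∷ x A z B) (cycle-length _ c))
      (subst (λ k → k % 4 ≡ 3) (length-∷-++-∷ x A z I) (cycle-length _ c₁))
      (subst (λ k → k % 4 ≡ 3) (trans (length-∷-++-∷ z B x (reverse I)) (cong (λ t → 2 + (length B + t)) (length-reverse I)))
         (cycle-length _ c₂))
    where
    A-or-I : ∀ A I → (I ≡ [] → ¬ CycleEdge (x ∷ A ++ z ∷ B) x z) → 1 ≤ length A + length I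
    A-or-I (_ ∷ _) I _ = s≤s z≤n
    A-or-I [] (_ ∷ _) _ = s≤s z≤n
    A-or-I [] [] ne = ⊥-elim (ne refl (inj₁ (here refl)))
    B-or-I : ∀ B I → (I ≡ [] → ¬ CycleEdge (x ∷ A ++ z ∷ B) x z) → 1 ≤ length B + length I
    B-or-I (_ ∷ _) I _ = s≤s z≤n
    B-or-I [] (_ ∷ _) _ = s≤s z≤n
    B-or-I [] [] ne = ⊥-elim (ne refl (inj₂ (subst (λ l → (z , x) ∈ links l) (cong (x ∷_) (sym (++-assoc A (z ∷ []) (x ∷ []))))
                                                (links-++⁺ʳ (x ∷ A) (z ∷ x ∷ []) (here refl)))))
    c₁ : IsCycle (x ∷ A ++ z ∷ I)
    c₁ = replace-arc x A z B I c dI disj ear (A-or-I A I not-edge)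
    ear′ : Chain Adj (x ∷ reverse I ++ z ∷ [])
    ear′ = subst (Chain Adj) (trans (reverse-++ (z ∷ I) (x ∷ [])) (cong (x ∷_) (unfold-reverse z I)))
             (Chain-reverse adj-sym (z ∷ I ++ x ∷ []) ear)
    c₂ : IsCycle (z ∷ B ++ x ∷ reverse I)
    c₂ = replace-arc z B x A (reverse I) (IsCycle-rotate (x ∷ A) (z ∷ B) c) (Distinct-reverse I dI)
           (λ (p , q) → disj (reverse⁻ p , ∈-rotate (z ∷ B) (x ∷ A) q))
           ear′ (subst (λ t → 1 ≤ length B + t) (sym (length-reverse I)) (B-or-I B I not-edge))

  no-theta : ∀ cs → IsCycle cs → ∀ {x z} → x ∈ cs → z ∈ cs → z ≢ x → ∀ I → Distinct I → Disjoint I cs →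
    Chain Adj (z ∷ I ++ x ∷ []) → (I ≡ [] → ¬ CycleEdge cs x z) → ⊥
  no-theta cs c {x} {z} x∈ z∈ z≢x I dI disj ear not-edge with ∈-∃++ x∈
  ... | X , Y , refl with ∈-rotate X (x ∷ Y) z∈
  ...   | here e = z≢x e
  ...   | there z∈YX with ∈-∃++ z∈YX
  ...     | A , B , eq = no-theta-arcs x A z B I rotated dI
                           (λ {v} (p , q) → disj (p , from-rotated (subst (λ l → v ∈ x ∷ l) (sym eq) q)))
                           ear (λ e edge → not-edge e (CycleEdge-rotate (x ∷ Y) X (subst (λ l → CycleEdge (x ∷ l) x z) (sym eq) edge)))
    where
    rotated : IsCycle (x ∷ A ++ z ∷ B)
    rotated = subst (λ l → IsCycle (x ∷ l)) eq (IsCycle-rotate X (x ∷ Y) c)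
    from-rotated : ∀ {v} → v ∈ x ∷ Y ++ X → v ∈ X ++ x ∷ Y
    from-rotated = ∈-rotate (x ∷ Y) X

  chord-free : ∀ cs → IsCycle cs → ∀ {u v} → u ∈ cs → v ∈ cs → Adj u v → CycleEdge cs u v
  chord-free cs c {u} {v} u∈ v∈ a with cycleEdge? cs u v
  ... | yes e = e
  ... | no ne = ⊥-elim (no-theta cs c u∈ v∈ (λ e → adj-irrefl a (sym e)) [] tt (λ ()) (adj-sym a , tt) (λ _ → ne))

  other-vertex : ∀ cs → IsCycle cs → ∀ x → ∃ λ z → z ∈ cs × z ≢ x
  other-vertex (a ∷ b ∷ t) (isCycle (a∉ , _) _ _) x with a ≟ x
  ... | yes refl = b , there (here refl) , λ e → a∉ (subst (_∈ b ∷ t) e (here refl))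
  ... | no a≢x = a , here refl , a≢x
  other-vertex (a ∷ []) (isCycle _ _ (s≤s ())) x
  other-vertex [] (isCycle _ _ ()) x

  -- A vertex of H off the cycle would give an edge xy leaving it, and a path from y back to the cycle
  -- avoiding x, because x is not a cut vertex: together with the cycle this is a theta.
  ear-free : ∀ cs → IsCycle cs → ∀ H → ConnectedSub {G} H → NoCutVertex {G} H →
    (∀ v → v ∈ cs → T (V H v)) → ∀ w → T (V H w) → w ∈ cs
  ear-free cs c H H-conn@(_ , conn) nc cs⊆H w w∈H with w ∈? cs
  ... | yes w∈ = w∈
  ... | no w∉ with other-vertex cs c w
  ...   | h , h∈ , _ with reach-exits cs (conn h w (cs⊆H h h∈) w∈H) h∈ w∉
  ...     | x , y , x∈ , y∉ , exy , _ with other-vertex cs c x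
  ...       | z₀ , z₀∈ , z₀≢x with simplify (E-symmetric H) cs y y∉ (noCutVertex-reach H H-conn nc x y z₀
                                   (proj₂ (E-ends H x y exy)) (cs⊆H z₀ z₀∈) (λ e → y∉ (subst (_∈ cs) (sym e) x∈)) z₀≢x)
  ...         | avoids K _ _ _ outside = ⊥-elim (outside (here refl) z₀∈)
  ...         | enters z L z∈ sz path ends dL outside =
                  ⊥-elim (no-theta cs c x∈ z∈ (V-without-≢ H sz) L dL (λ (p , q) → outside p q) ear nonempty)
    where
    ear : Chain Adj (z ∷ L ++ x ∷ [])
    ear = Chain-map (λ {a} {b} → E-adj H a b) (z ∷ L ++ x ∷ [])
            (Chain-snoc (z ∷ L) path (EndsAt-∷ z L ends) (E-symmetric H x y exy))
    nonempty : L ≡ [] → ¬ CycleEdge cs x z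
    nonempty refl = ⊥-elim ends

  cycleSubgraph-isBlock : ∀ cs (c : IsCycle cs) → IsBlock {G} (cycleSubgraph cs c)
  cycleSubgraph-isBlock cs c = cycleSubgraph-connected cs c , cycleSubgraph-noCutVertex cs c , maximal
    where
    maximal : ∀ H → ConnectedSub {G} H → NoCutVertex {G} H → _⊑_ {G} (cycleSubgraph cs c) H → _⊑_ {G} H (cycleSubgraph cs c)
    maximal H conn nc (V⊆ , _) =
      (λ v t → fromWitness (inH v t)) ,
      (λ u v t → fromWitness (chord-free cs c (inH u (proj₁ (E-ends H u v t))) (inH v (proj₂ (E-ends H u v t))) (E-adj H u v t)))
      where
      inH : ∀ w → T (V H w) → w ∈ cs
      inH = ear-free cs c H conn nc (λ v v∈ → V⊆ v (fromWitness v∈))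

  block-on-cycle : ∀ B → IsBlock {G} B → ∀ {u v} → T (E B u v) → ∀ cs (c : IsCycle cs) → CycleEdge cs u v →
    _≈_ {G} B (cycleSubgraph cs c)
  block-on-cycle B B-block {u} {v} e cs c edge =
    blocks-sharing-two-vertices B (cycleSubgraph cs c) B-block (cycleSubgraph-isBlock cs c)
      (adj-irrefl (E-adj B u v e)) (proj₁ (E-ends B u v e)) (proj₂ (E-ends B u v e))
      (fromWitness (proj₁ (CycleEdge-ends cs edge))) (fromWitness (proj₂ (CycleEdge-ends cs edge)))

module EvenDegrees (G : Graph) (even : ∀ v → 2 ∣ degree G v) where
  open Subgraphs G

  deg-even : ∀ a → 2 ∣ deg G a
  deg-even a = subst (2 ∣_) (degree≡deg G a) (even a)

  module WithoutEdge {u v : Vertex} (uv : Adj u v) where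
    IsUV : Vertex → Vertex → Bool
    IsUV a b = (a == u ∧ b == v) ∨ (a == v ∧ b == u)

    E′ : Vertex → Vertex → Bool
    E′ a b = adj G a b ∧ not (IsUV a b)

    deg′ : Vertex → ℕ
    deg′ a = ∑ (λ b → 𝟙 (E′ a b))

    IsUV-sym : ∀ a b → T (IsUV a b) → T (IsUV b a)
    IsUV-sym a b t with T-∨-elim {a == u ∧ b == v} t
    ... | inj₁ p = T-∨₂ {b == u ∧ a == v} (T-∧-intro (T-∧₂ {a == u} p) (T-∧₁ p))
    ... | inj₂ p = T-∨₁ (T-∧-intro (T-∧₂ {a == v} p) (T-∧₁ p))

    IsUV⇒adj : ∀ a b → T (IsUV a b) → Adj a b
    IsUV⇒adj a b t with T-∨-elim {a == u ∧ b == v} t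
    ... | inj₁ p with ==⇒≡ {x = a} (T-∧₁ p) | ==⇒≡ {x = b} (T-∧₂ {a == u} p)
    ...   | refl | refl = uv
    IsUV⇒adj a b t | inj₂ p with ==⇒≡ {x = a} (T-∧₁ p) | ==⇒≡ {x = b} (T-∧₂ {a == v} p)
    ...   | refl | refl = adj-sym uv

    E′-sym : ∀ a b → E′ a b ≡ E′ b a
    E′-sym a b = cong₂ _∧_ (adj-sym′ G a b) (cong not (T-injective (IsUV-sym a b) (IsUV-sym b a)))

    E′-irrefl : ∀ a → E′ a a ≡ false
    E′-irrefl a rewrite irrefl G a = refl

    𝟙-adj : ∀ a b → 𝟙 (adj G a b) ≡ 𝟙 (E′ a b) + 𝟙 (IsUV a b)
    𝟙-adj a b with adj G a b in ea | IsUV a b in e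
    ... | true | true = refl
    ... | true | false = refl
    ... | false | false = refl
    ... | false | true = ⊥-elim (subst T ea (IsUV⇒adj a b (subst T (sym e) tt)))

    𝟙-IsUV : ∀ a b → 𝟙 (IsUV a b) ≡ 𝟙 (a == u) * 𝟙 (b == v) + 𝟙 (a == v) * 𝟙 (b == u)
    𝟙-IsUV a b with a == u in e₁ | a == v in e₂ | b == v | b == u
    ... | true | true | _ | _ = ⊥-elim (adj-irrefl uv (trans (sym (==⇒≡ {x = a} (subst T (sym e₁) tt))) (==⇒≡ {x = a} (subst T (sym e₂) tt))))
    ... | true | false | true | _ = refl
    ... | true | false | false | _ = refl
    ... | false | true | _ | true = refl
    ... | false | true | _ | false = refl
    ... | false | false | _ | _ = refl

    deg-split : ∀ a → deg G a ≡ deg′ a + (𝟙 (a == u) + 𝟙 (a == v))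
    deg-split a = begin
        ∑ (λ b → 𝟙 (adj G a b))
      ≡⟨ trans (sum-cong-≗ (𝟙-adj a)) (∑-distrib-+ (λ b → 𝟙 (E′ a b)) (λ b → 𝟙 (IsUV a b))) ⟩
        deg′ a + ∑ (λ b → 𝟙 (IsUV a b))
      ≡⟨ cong (deg′ a +_) (trans (sum-cong-≗ (𝟙-IsUV a)) (∑-distrib-+ (λ b → 𝟙 (a == u) * 𝟙 (b == v)) (λ b → 𝟙 (a == v) * 𝟙 (b == u)))) ⟩
        deg′ a + (∑ (λ b → 𝟙 (a == u) * 𝟙 (b == v)) + ∑ (λ b → 𝟙 (a == v) * 𝟙 (b == u)))
      ≡⟨ cong (deg′ a +_) (cong₂ _+_ (pick (𝟙 (a == u)) v) (pick (𝟙 (a == v)) u)) ⟩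
        deg′ a + (𝟙 (a == u) + 𝟙 (a == v))
      ∎
      where
      open ≡-Reasoning
      pick : ∀ k w → ∑ (λ b → k * 𝟙 (b == w)) ≡ k
      pick k w = trans (sym (*-distribˡ-sum k (λ b → 𝟙 (b == w)))) (trans (cong (k *_) (∑-𝟙-==ˡ w)) (*-identityʳ k))

    ∑-deg-split : ∀ (R : Vertex → Bool) → ∑ (λ a → 𝟙 (R a) * deg G a) ≡ ∑ (λ a → 𝟙 (R a) * deg′ a) + (𝟙 (R u) + 𝟙 (R v))
    ∑-deg-split R = begin
        ∑ (λ a → 𝟙 (R a) * deg G a)
      ≡⟨ sum-cong-≗ (λ a → trans (cong (𝟙 (R a) *_) (deg-split a)) (distrib (𝟙 (R a)) (deg′ a) (𝟙 (a == u)) (𝟙 (a == v)))) ⟩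
        ∑ (λ a → 𝟙 (R a) * deg′ a + (𝟙 (R a) * 𝟙 (a == u) + 𝟙 (R a) * 𝟙 (a == v)))
      ≡⟨ ∑-distrib-+ (λ a → 𝟙 (R a) * deg′ a) (λ a → 𝟙 (R a) * 𝟙 (a == u) + 𝟙 (R a) * 𝟙 (a == v)) ⟩
        ∑ (λ a → 𝟙 (R a) * deg′ a) + ∑ (λ a → 𝟙 (R a) * 𝟙 (a == u) + 𝟙 (R a) * 𝟙 (a == v))
      ≡⟨ cong (∑ (λ a → 𝟙 (R a) * deg′ a) +_) (∑-distrib-+ (λ a → 𝟙 (R a) * 𝟙 (a == u)) (λ a → 𝟙 (R a) * 𝟙 (a == v))) ⟩
        ∑ (λ a → 𝟙 (R a) * deg′ a) + (∑ (λ a → 𝟙 (R a) * 𝟙 (a == u)) + ∑ (λ a → 𝟙 (R a) * 𝟙 (a == v)))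
      ≡⟨ cong (∑ (λ a → 𝟙 (R a) * deg′ a) +_) (cong₂ _+_ (∑-𝟙-== (λ a → 𝟙 (R a)) u) (∑-𝟙-== (λ a → 𝟙 (R a)) v)) ⟩
        ∑ (λ a → 𝟙 (R a) * deg′ a) + (𝟙 (R u) + 𝟙 (R v))
      ∎
      where
      open ≡-Reasoning
      distrib : ∀ r d x y → r * (d + (x + y)) ≡ r * d + (r * x + r * y)
      distrib = solve-∀

    -- The part of G - uv reachable from v is closed, so its degree sum in G - uv is even;
    -- its degree sum in G is even too, and they differ by one unless u is reachable.
    v-reaches-u : Reach (λ _ → true) E′ v u
    v-reaches-u with reach? (λ _ → true) E′ v u
    ... | yes r = r
    ... | no u-unreached = ⊥-elim (2∤1 (∣m+n∣m⇒∣n (subst (2 ∣_) odd-in-G in-G) in-G-uv))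
      where
      R : Vertex → Bool
      R a = ⌊ reach? (λ _ → true) E′ v a ⌋
      in-G-uv : 2 ∣ ∑ (λ a → 𝟙 (R a) * deg′ a)
      in-G-uv = handshake-closed E′ E′-sym E′-irrefl R (λ a b ra e → fromWitness (step (toWitness ra) e tt))
      in-G : 2 ∣ ∑ (λ a → 𝟙 (R a) * deg G a)
      in-G = ∑-divisible 2 _ (λ a → ∣n⇒∣m*n (𝟙 (R a)) (deg-even a))
      odd-in-G : ∑ (λ a → 𝟙 (R a) * deg G a) ≡ ∑ (λ a → 𝟙 (R a) * deg′ a) + 1
      odd-in-G = trans (∑-deg-split R) (cong (∑ (λ a → 𝟙 (R a) * deg′ a) +_)
                   (cong₂ _+_ (𝟙-false (λ t → u-unreached (toWitness t)))
                              (𝟙-true (fromWitness {a? = reach? (λ _ → true) E′ v v} (here tt)))))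
      2∤1 : ¬ (2 ∣ 1)
      2∤1 d with ∣1⇒≡1 d
      ... | ()

    cycle-through-edge : ∃ λ cs → IsCycle cs × CycleEdge cs u v
    cycle-through-edge with simplify {S = λ _ → true} {E′ = E′} (λ a b t → subst T (E′-sym a b) t) [] v (λ ()) v-reaches-u
    ... | enters _ _ () _ _ _ _ _
    ... | avoids K path ends d _ =
            u ∷ K , isCycle d (Chain-snoc (u ∷ K) (Chain-map T-∧₁ (u ∷ K) path) ends (adj-sym uv)) (length≥3 K path ends) ,
            closing-link K ends
      where
      u≢v : u ≢ v
      u≢v = adj-irrefl uv
      length≥3 : ∀ K → Chain (λ a b → T (E′ a b)) (u ∷ K) → EndsAt (u ∷ K) v → 3 ≤ length (u ∷ K)
      length≥3 [] _ e = ⊥-elim (u≢v e)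
      length≥3 (k ∷ []) (e , _) refl = ⊥-elim (T-not⁻ (T-∧₂ {adj G u v} e) (T-∨₁ (T-∧-intro (≡⇒== {x = u} refl) (≡⇒== {x = v} refl))))
      length≥3 (k ∷ k′ ∷ K) _ _ = s≤s (s≤s (s≤s z≤n))
      closing-link : ∀ K → EndsAt (u ∷ K) v → CycleEdge (u ∷ K) u v
      closing-link K e with EndsAt⇒snoc (u ∷ K) e
      ... | [] , refl = ⊥-elim (u≢v refl)
      ... | _ ∷ K′ , refl = inj₂ (subst (λ l → (v , u) ∈ links l) (cong (u ∷_) (sym (++-assoc K′ (v ∷ []) (u ∷ []))))
                                   (links-++⁺ʳ (u ∷ K′) (v ∷ u ∷ []) (here refl)))

  open WithoutEdge using (cycle-through-edge) public

module GracefulEuler (G : Graph) (even : ∀ v → 2 ∣ degree G v) (graceful : Graceful G) where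
  open Subgraphs G using (Vertex; adj-irrefl)
  open EvenDegrees G even using (deg-even)

  φ : Vertex → ℕ
  φ = proj₁ graceful

  q : ℕ
  q = numEdges G

  label : Vertex → Vertex → ℕ
  label u v = ∣ φ u - φ v ∣

  labelIf : Bool → Vertex → Vertex → List ℕ
  labelIf b u v = if b then label u v ∷ [] else []

  row : Vertex → List ℕ
  row u = concatᶠ (λ v → labelIf (EdgeUp G u v) u v)

  labels : List ℕ
  labels = concatᶠ row

  length-labels : length labels ≡ q
  length-labels = trans (length-concatᶠ row)
    (trans (sum-cong-≗ (λ u → trans (length-concatᶠ (λ v → labelIf (EdgeUp G u v) u v))
                                    (sum-cong-≗ (λ v → length-labelIf (EdgeUp G u v) u v))))
           (sym (numEdges≡∑² G)))
    where
    length-labelIf : ∀ b u v → length (labelIf b u v) ≡ 𝟙 b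
    length-labelIf true u v = refl
    length-labelIf false u v = refl

  sum-labels : sum labels ≡ ∑² (λ u v → 𝟙 (EdgeUp G u v) * label u v)
  sum-labels = trans (sum-concatᶠ row)
    (sum-cong-≗ (λ u → trans (sum-concatᶠ (λ v → labelIf (EdgeUp G u v) u v)) (sum-cong-≗ (λ v → sum-labelIf (EdgeUp G u v) u v))))
    where
    sum-labelIf : ∀ b u v → sum (labelIf b u v) ≡ 𝟙 b * label u v
    sum-labelIf true u v = trans (+-identityʳ _) (sym (*-identityˡ _))
    sum-labelIf false u v = refl

  ∈-labelIf : ∀ b {u v x} → x ∈ labelIf b u v → T b × x ≡ label u v
  ∈-labelIf true (here e) = tt , e

  ∈-labels⁻ : ∀ x → x ∈ labels → ∃₂ λ u v → T (adj G u v) × x ≡ label u v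
  ∈-labels⁻ x p with ∈-concatᶠ⁻ row p
  ... | u , p′ with ∈-concatᶠ⁻ (λ v → labelIf (EdgeUp G u v) u v) p′
  ...   | v , p″ with ∈-labelIf (EdgeUp G u v) p″
  ...     | t , e = u , v , T-∧₁ t , e

  ∈-labels⁺ : ∀ u v → T (EdgeUp G u v) → label u v ∈ labels
  ∈-labels⁺ u v t = ∈-concatᶠ⁺ row u (∈-concatᶠ⁺ (λ w → labelIf (EdgeUp G u w) u w) v
                      (subst (λ b → label u v ∈ labelIf b u v) (sym (Equivalence.to T-≡ t)) (here refl)))

  labels-bounded : ∀ x → x ∈ labels → x ≤ q
  labels-bounded x p with ∈-labels⁻ x p
  ... | u , v , a , refl = proj₂ (proj₁ (proj₂ (proj₂ (proj₂ graceful))) u v a)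

  labels-cover : Covers q labels
  labels-cover l 1≤l l≤q with proj₂ (proj₂ (proj₂ (proj₂ graceful))) l 1≤l l≤q
  ... | u , v , a , refl with <-cmp (toℕ u) (toℕ v)
  ...   | tri< u<v _ _ = ∈-labels⁺ u v (T-∧-intro a (<⇒<ᵇ u<v))
  ...   | tri≈ _ u≡v _ = ⊥-elim (adj-irrefl a (toℕ-injective u≡v))
  ...   | tri> _ _ v<u = subst (_∈ labels) (∣-∣-comm (φ v) (φ u)) (∈-labels⁺ v u (T-∧-intro (subst T (adj-sym′ G u v) a) (<⇒<ᵇ v<u)))

  sum-labels≡triangular : sum labels ≡ triangular q
  sum-labels≡triangular = sum-covering q labels length-labels labels-bounded labels-cover

  endpoints : Vertex → Vertex → ℕ
  endpoints u v = 𝟙 (adj G u v) * (φ u + φ v)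

  ∑²-endpoints : ∑² endpoints ≡ 2 * ∑ (λ u → φ u * deg G u)
  ∑²-endpoints = begin
      ∑² endpoints
    ≡⟨ sum-cong-≗ (λ u → trans (sum-cong-≗ (λ v → *-distribˡ-+ (𝟙 (adj G u v)) (φ u) (φ v)))
                                (∑-distrib-+ (λ v → 𝟙 (adj G u v) * φ u) (λ v → 𝟙 (adj G u v) * φ v))) ⟩
      ∑ (λ u → ∑ (λ v → 𝟙 (adj G u v) * φ u) + ∑ (λ v → 𝟙 (adj G u v) * φ v))
    ≡⟨ ∑-distrib-+ (λ u → ∑ (λ v → 𝟙 (adj G u v) * φ u)) (λ u → ∑ (λ v → 𝟙 (adj G u v) * φ v)) ⟩
      X + ∑² (λ u v → 𝟙 (adj G u v) * φ v)
    ≡⟨ cong (X +_) (trans (∑-comm (λ u v → 𝟙 (adj G u v) * φ v))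
                          (sum-cong-≗ (λ v → sum-cong-≗ (λ u → cong (λ b → 𝟙 b * φ v) (adj-sym′ G u v))))) ⟩
      X + X
    ≡⟨ cong (λ t → t + t) X≡ ⟩
      Y + Y
    ≡⟨ cong (Y +_) (sym (+-identityʳ Y)) ⟩
      2 * Y
    ∎
    where
    open ≡-Reasoning
    X = ∑² (λ u v → 𝟙 (adj G u v) * φ u)
    Y = ∑ (λ u → φ u * deg G u)
    X≡ : X ≡ Y
    X≡ = sum-cong-≗ (λ u → trans (sum-cong-≗ (λ v → *-comm (𝟙 (adj G u v)) (φ u))) (sym (*-distribˡ-sum (φ u) (λ v → 𝟙 (adj G u v)))))

  ∑²-endpoints-even : 2 ∣ ∑² (λ u v → 𝟙< u v * endpoints u v)
  ∑²-endpoints-even = subst (2 ∣_) (sym each-edge-once) (∑-divisible 2 (λ u → φ u * deg G u) (λ u → ∣n⇒∣m*n (φ u) (deg-even u)))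
    where
    each-edge-once : ∑² (λ u v → 𝟙< u v * endpoints u v) ≡ ∑ (λ u → φ u * deg G u)
    each-edge-once = *-cancelˡ-≡ _ _ 2 (trans (sym (∑²-symmetric endpoints
                       (λ u v → cong₂ _*_ (cong 𝟙 (adj-sym′ G u v)) (+-comm (φ u) (φ v)))
                       (λ u → cong (_* (φ u + φ u)) (cong 𝟙 (irrefl G u))))) ∑²-endpoints)

  endpoints≡label : ∀ u v → 𝟙< u v * endpoints u v ≡ 𝟙 (EdgeUp G u v) * label u v + 2 * (𝟙 (EdgeUp G u v) * (φ u ⊓ φ v))
  endpoints≡label u v = begin
      𝟙< u v * (𝟙 (adj G u v) * (φ u + φ v))
    ≡⟨ cong (λ t → 𝟙< u v * (𝟙 (adj G u v) * t)) (sym (∣m-n∣+2*[m⊓n]≡m+n (φ u) (φ v))) ⟩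
      𝟙< u v * (𝟙 (adj G u v) * (label u v + 2 * (φ u ⊓ φ v)))
    ≡⟨ rearrange (𝟙< u v) (𝟙 (adj G u v)) (label u v) (φ u ⊓ φ v) ⟩
      (𝟙 (adj G u v) * 𝟙< u v) * label u v + 2 * ((𝟙 (adj G u v) * 𝟙< u v) * (φ u ⊓ φ v))
    ≡⟨ cong (λ t → t * label u v + 2 * (t * (φ u ⊓ φ v))) (sym (𝟙-∧ (adj G u v) (toℕ u <ᵇ toℕ v))) ⟩
      𝟙 (EdgeUp G u v) * label u v + 2 * (𝟙 (EdgeUp G u v) * (φ u ⊓ φ v))
    ∎
    where
    open ≡-Reasoning
    rearrange : ∀ l a x m → l * (a * (x + 2 * m)) ≡ (a * l) * x + 2 * ((a * l) * m)
    rearrange = solve-∀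

  ∑²-endpoints≡labels : ∑² (λ u v → 𝟙< u v * endpoints u v) ≡ 2 * ∑² (λ u v → 𝟙 (EdgeUp G u v) * (φ u ⊓ φ v)) + sum labels
  ∑²-endpoints≡labels = begin
      ∑² (λ u v → 𝟙< u v * endpoints u v)
    ≡⟨ sum-cong-≗ (λ u → trans (sum-cong-≗ (endpoints≡label u))
         (trans (∑-distrib-+ (λ v → 𝟙 (EdgeUp G u v) * label u v) (λ v → 2 * (𝟙 (EdgeUp G u v) * (φ u ⊓ φ v))))
                (cong (L u +_) (sym (*-distribˡ-sum 2 (λ v → 𝟙 (EdgeUp G u v) * (φ u ⊓ φ v))))))) ⟩
      ∑ (λ u → L u + 2 * N u)
    ≡⟨ ∑-distrib-+ L (λ u → 2 * N u) ⟩
      ∑ L + ∑ (λ u → 2 * N u)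
    ≡⟨ cong (∑ L +_) (sym (*-distribˡ-sum 2 N)) ⟩
      ∑ L + 2 * ∑ N
    ≡⟨ +-comm (∑ L) (2 * ∑ N) ⟩
      2 * ∑ N + ∑ L
    ≡⟨ cong (2 * ∑ N +_) (sym sum-labels) ⟩
      2 * ∑ N + sum labels
    ∎
    where
    open ≡-Reasoning
    L N : Vertex → ℕ
    L u = ∑ (λ v → 𝟙 (EdgeUp G u v) * label u v)
    N u = ∑ (λ v → 𝟙 (EdgeUp G u v) * (φ u ⊓ φ v))

  sum-labels-even : 2 ∣ sum labels
  sum-labels-even = ∣m+n∣m⇒∣n (subst (2 ∣_) ∑²-endpoints≡labels ∑²-endpoints-even) (∣m⇒∣m*n (∑² (λ u v → 𝟙 (EdgeUp G u v) * (φ u ⊓ φ v))) ∣-refl)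

  numEdges-mod-4 : q % 4 ≡ 0 ⊎ q % 4 ≡ 3
  numEdges-mod-4 = triangular-even q (subst (2 ∣_) sum-labels≡triangular sum-labels-even)

module BlockDecomposition (G : Graph) (even : ∀ v → 2 ∣ degree G v) (cycles≡3 : ∀ k → Cycle G k → k % 4 ≡ 3) where
  open Subgraphs G
  open Eps3 G cycles≡3
  open EvenDegrees G even

  module _ (no-isolated : ∀ x → ∃ λ y → Adj x y) where
    -- an edgeless block is a single vertex x, but it lies inside the cycle through any edge at x
    block-has-edge : ∀ B → IsBlock {G} B → ∃₂ λ u v → T (E B u v)
    block-has-edge B (((x , x∈B) , B-conn) , _ , B-maximal)
      with ∃ᶠ-or-∀ᶠ (λ a → anyᶠ (λ b → E B a b))
    ... | inj₁ (a , t) = a , anyᶠ-elim (λ b → E B a b) t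
    ... | inj₂ none = ⊥-elim (adj-irrefl xy (only-x y (proj₁ C⊑B y (fromWitness (proj₂ (CycleEdge-ends cs xy∈cs))))))
      where
      edgeless : ∀ a b → ¬ T (E B a b)
      edgeless a b t = none a (anyᶠ-intro (λ b → E B a b) b t)
      only-x : ∀ a → T (V B a) → x ≡ a
      only-x a a∈B = reach-edgeless edgeless (B-conn x a x∈B a∈B)
      y = proj₁ (no-isolated x)
      xy = proj₂ (no-isolated x)
      cs = proj₁ (cycle-through-edge xy)
      c = proj₁ (proj₂ (cycle-through-edge xy))
      xy∈cs = proj₂ (proj₂ (cycle-through-edge xy))
      C = cycleSubgraph cs c
      B⊑C : _⊑_ {G} B C
      B⊑C = (λ a a∈B → fromWitness (subst (_∈ cs) (only-x a a∈B) (proj₁ (CycleEdge-ends cs xy∈cs)))) ,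
            (λ a b t → ⊥-elim (edgeless a b t))
      C⊑B : _⊑_ {G} C B
      C⊑B = B-maximal C (cycleSubgraph-connected cs c) (cycleSubgraph-noCutVertex cs c) B⊑C

    block-edgeCount : ∀ B → IsBlock {G} B → edgeCount B % 4 ≡ 3
    block-edgeCount B B-block with block-has-edge B B-block
    ... | u , v , uv∈B with cycle-through-edge (E-adj B u v uv∈B)
    ...   | cs , c , uv∈cs = subst (λ k → k % 4 ≡ 3)
              (sym (trans (edgeCount-≈ B (cycleSubgraph cs c) (block-on-cycle B B-block uv∈B cs c uv∈cs)) (edgeCount-cycleSubgraph cs c)))
              (cycle-length cs c)

  module _ (bs : List (Subgraph G)) (blocks : BlockList {G} bs) where
    private
      listed : ∀ H → H ∈ bs → IsBlock {G} H
      listed = proj₁ blocks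
      complete : ∀ H → IsBlock {G} H → ∃ λ H′ → H′ ∈ bs × _≈_ {G} H H′
      complete = proj₁ (proj₂ blocks)
      pairwise-distinct : AllPairs (λ H H′ → ¬ (_≈_ {G} H H′)) bs
      pairwise-distinct = proj₂ (proj₂ blocks)

    𝟙-adj≡blocks : ∀ u v → 𝟙 (adj G u v) ≡ sum (map (λ B → 𝟙 (E B u v)) bs)
    𝟙-adj≡blocks u v with T? (adj G u v)
    ... | no ¬uv = trans (𝟙-false ¬uv) (sym (sum-𝟙-none bs (λ B → E B u v) (λ B _ t → ¬uv (E-adj B u v t))))
    ... | yes uv with cycle-through-edge uv
    ...   | cs , c , uv∈cs with complete (cycleSubgraph cs c) (cycleSubgraph-isBlock cs c)
    ...     | B , B∈bs , ((_ , C⊆B) , _) =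
              trans (𝟙-true uv) (sym (sum-𝟙-unique bs (λ B → E B u v) (_≈_ {G}) pairwise-distinct same B∈bs (C⊆B u v (fromWitness uv∈cs))))
      where
      same : ∀ B₁ B₂ → B₁ ∈ bs → B₂ ∈ bs → T (E B₁ u v) → T (E B₂ u v) → _≈_ {G} B₁ B₂
      same B₁ B₂ B₁∈ B₂∈ t₁ t₂ with block-on-cycle B₁ (listed B₁ B₁∈) t₁ cs c uv∈cs | block-on-cycle B₂ (listed B₂ B₂∈) t₂ cs c uv∈cs
      ... | (B₁⊑C , C⊑B₁) | (B₂⊑C , C⊑B₂) = ⊑-trans {B₁} {cycleSubgraph cs c} {B₂} B₁⊑C C⊑B₂ , ⊑-trans {B₂} {cycleSubgraph cs c} {B₁} B₂⊑C C⊑B₁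

    numEdges≡∑edgeCount : numEdges G ≡ sum (map edgeCount bs)
    numEdges≡∑edgeCount = begin
        numEdges G
      ≡⟨ numEdges≡∑² G ⟩
        ∑² (λ u v → 𝟙 (EdgeUp G u v))
      ≡⟨ sum-cong-≗ (λ u → sum-cong-≗ (λ v → trans (𝟙-∧ (adj G u v) _)
           (trans (cong (_* 𝟙< u v) (𝟙-adj≡blocks u v)) (sum-map-*ʳ bs (λ B → 𝟙 (E B u v)) (𝟙< u v))))) ⟩
        ∑ (λ u → ∑ (λ v → sum (map (λ B → 𝟙 (E B u v) * 𝟙< u v) bs)))
      ≡⟨ sum-cong-≗ (λ u → ∑-sum-map bs (λ B v → 𝟙 (E B u v) * 𝟙< u v)) ⟩
        ∑ (λ u → sum (map (λ B → ∑ (λ v → 𝟙 (E B u v) * 𝟙< u v)) bs))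
      ≡⟨ ∑-sum-map bs (λ B u → ∑ (λ v → 𝟙 (E B u v) * 𝟙< u v)) ⟩
        sum (map edgeCount bs)
      ∎
      where open ≡-Reasoning

    numEdges≡3b-mod-4 : (∀ x → ∃ λ y → Adj x y) → numEdges G % 4 ≡ (3 * length bs) % 4
    numEdges≡3b-mod-4 no-isolated = trans (cong (_% 4) numEdges≡∑edgeCount)
      (sum-map-mod-4 bs edgeCount (λ B B∈ → block-edgeCount no-isolated B (listed B B∈)))

    blocks-nonempty : ∀ {u v} → Adj u v → 1 ≤ length bs
    blocks-nonempty uv with cycle-through-edge uv
    ... | cs , c , _ with complete (cycleSubgraph cs c) (cycleSubgraph-isBlock cs c)
    ...   | _ , here _ , _ = s≤s z≤n
    ...   | _ , there _ , _ = s≤s z≤n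

module SingleVertex (G : Graph) (one-vertex : n G ≡ 1) where
  open Subgraphs G

  same-vertex : ∀ (a b : Vertex) → a ≡ b
  same-vertex = unique one-vertex
    where
    unique : ∀ {k} → k ≡ 1 → (a b : Fin k) → a ≡ b
    unique refl zero zero = refl

  edgeless : ∀ (H : Subgraph G) a b → ¬ T (E H a b)
  edgeless H a b t = adj-irrefl (E-adj H a b t) (same-vertex a b)

  whole : Subgraph G
  whole = record { V = λ _ → true ; E = λ _ _ → false ; E-sym = λ _ _ → refl ; E-adj = λ _ _ () ; E-ends = λ _ _ () }

  whole-isBlock : IsBlock {G} whole
  whole-isBlock = ((subst Fin (sym one-vertex) zero , tt) , (λ a b ta tb → subst (Reach _ _ a) (same-vertex a b) (here ta))) ,
                  noCutVertex-intro whole (λ z a b ta tb → subst (Reach _ _ a) (same-vertex a b) (here ta)) ,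
                  (λ H _ _ _ → (λ _ _ → tt) , (λ a b t → ⊥-elim (edgeless H a b t)))

  blocks-⊑ : ∀ B B′ → IsBlock {G} B → IsBlock {G} B′ → _⊑_ {G} B B′
  blocks-⊑ B B′ _ (((x , x∈B′) , _) , _) = (λ a _ → subst (λ z → T (V B′ z)) (same-vertex x a) x∈B′) , (λ a b t → ⊥-elim (edgeless B a b t))

  one-block : ∀ bs → BlockList {G} bs → length bs ≡ 1
  one-block bs (listed , complete , pairwise-distinct) = at-most-one bs listed pairwise-distinct (proj₁ (proj₂ (complete whole whole-isBlock)))
    where
    at-most-one : ∀ bs → (∀ H → H ∈ bs → IsBlock {G} H) → AllPairs (λ H H′ → ¬ (_≈_ {G} H H′)) bs → ∀ {B} → B ∈ bs → length bs ≡ 1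
    at-most-one (B₁ ∷ []) _ _ _ = refl
    at-most-one (B₁ ∷ B₂ ∷ _) blocks ((B₁≉B₂ ∷ _) ∷ _) _ =
      ⊥-elim (B₁≉B₂ (blocks-⊑ B₁ B₂ (blocks B₁ (here refl)) (blocks B₂ (there (here refl))) ,
                     blocks-⊑ B₂ B₁ (blocks B₂ (there (here refl))) (blocks B₁ (here refl))))

0-1-or-more : ∀ k → k ≡ 0 ⊎ k ≡ 1 ⊎ 2 ≤ k
0-1-or-more 0 = inj₁ refl
0-1-or-more 1 = inj₂ (inj₁ refl)
0-1-or-more (suc (suc k)) = inj₂ (inj₂ (s≤s (s≤s z≤n)))

corollary17p3 : (G : Graph) → InEps3 G → Graceful G → (b : ℕ) → NumBlocks G b →
    ∃ λ (t : ℕ) → (b ≡ 4 * (t + 1)) ⊎ (b ≡ 4 * t + 1)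
corollary17p3 G ((conn , even) , cycles≡3) graceful b (bs , blocks , refl) with 0-1-or-more (n G)
... | inj₁ no-vertex = ⊥-elim (¬Fin0 (subst Fin no-vertex (proj₁ (proj₁ conn))))
... | inj₂ (inj₁ one-vertex) = 0 , inj₂ (SingleVertex.one-block G one-vertex bs blocks)
... | inj₂ (inj₂ two) = count-mod-4 (length bs)
      (blocks-nonempty bs blocks (proj₂ (has-neighbour G conn two (proj₁ (proj₁ conn)))))
      (subst (λ r → r ≡ 0 ⊎ r ≡ 3) (numEdges≡3b-mod-4 bs blocks (has-neighbour G conn two)) numEdges-mod-4)
  where
  open BlockDecomposition G even cycles≡3 using (blocks-nonempty; numEdges≡3b-mod-4)
  open GracefulEuler G even graceful using (numEdges-mod-4)
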